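{- Let $(P,\rho)$ be a weakly ranked locally finite poset, $\kappa$ a $(P,\rho)$-kernel and $\mathrm{H}$ its Chow function. Then $\mathrm{H}\in\mathcal{I}_\rho(P)$ satisfies (i) $\mathrm{H}_{ss}(x)=1$ for all $s\in P$; (ii) for every $s<t$, $\mathrm{H}_{st}(x)$ is symmetric with center of symmetry $\tfrac12(\rho_{st}-1)$, i.e. $\mathrm{H}_{st}(x)=x^{\rho_{st}-1}\mathrm{H}_{st}(x^{ -1})$; and (iii) $\kappa\mathrm{H}=\mathrm{H}^{\mathrm{rev}}$ and $\mathrm{H}\kappa=\mathrm{H}^{\mathrm{rev}}$. Moreover, $\mathrm{H}$ is the unique element of $\mathcal{I}_\rho(P)$ satisfying (i), (ii), and at least one of the equations $\kappa\mathrm{H}=\mathrm{H}^{\mathrm{rev}}$ or $\mathrm{H}\kappa=\mathrm{H}^{\mathrm{rev}}$.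
   Context: $P$ is a locally finite poset; $\operatorname{Int}(P)$ is its set of closed intervals. A weak rank function is a map $\rho:\operatorname{Int}(P)\to\mathbb{Z}_{\ge0}$, $[s,t]\mapsto\rho_{st}$, with $\rho_{st}>0$ whenever $s<t$ and $\rho_{st}=\rho_{sw}+\rho_{wt}$ for $s\le w\le t$. The incidence algebra $\mathcal{I}(P)$ consists of maps $a$ assigning to each $[s,t]$ a polynomial $a_{st}(x)\in\mathbb{Z}[x]$, with product $(ab)_{st}=\sum_{s\le w\le t}a_{sw}b_{wt}$. $\mathcal{I}_\rho(P)=\{a:\deg a_{st}\le\rho_{st}\}$, and $a^{\mathrm{rev}}_{st}(x)=x^{\rho_{st}}a_{st}(x^{ -1})$. A $(P,\rho)$-kernel is $\kappa\in\mathcal{I}_\rho(P)$ with $\kappa_{ss}=1$ for all $s$ and $\kappa^{ -1}=\kappa^{\mathrm{rev}}$. For $s<t$, $\kappa_{st}$ is divisible by $x-1$; the reduced kernel has $\overline{\kappa}_{st}=\kappa_{st}/(x-1)$ for $s<t$ and $\overline{\kappa}_{ss}=-1$. The Chow function is $\mathrm{H}=-(\overline{\kappa})^{ -1}$. -}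

module Defs where

open import Data.Nat using (ℕ; zero; suc; _∸_) renaming (_<_ to _<ℕ_)
open import Data.Nat.Base using (_+_)
open import Data.Integer using (ℤ; 0ℤ; 1ℤ; -1ℤ) renaming (_+_ to _+ℤ_; _*_ to _*ℤ_; -_ to -ℤ_)
open import Data.List using (List; []; _∷_; map; foldr; upTo)
open import Data.List.Membership.Propositional using (_∈_)
open import Data.List.Relation.Unary.Unique.Propositional using (Unique)
open import Data.Product using (Σ; _×_; _,_)
open import Relation.Binary.PropositionalEquality using (_≡_; _≢_)
open import Relation.Binary.Structures using (IsPartialOrder)
open import Function.Bundles using (_⇔_)

-- Polynomials in ℤ[x], as coefficient lists (constant term first).
-- Equality is coefficientwise (so trailing zeros are irrelevant).

Poly : Set
Poly = List ℤ

coeff : Poly → ℕ → ℤ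
coeff []       _       = 0ℤ
coeff (a ∷ p)  zero    = a
coeff (a ∷ p)  (suc k) = coeff p k

infix 4 _≈ₚ_
_≈ₚ_ : Poly → Poly → Set
p ≈ₚ q = ∀ k → coeff p k ≡ coeff q k

infixl 6 _+ₚ_
_+ₚ_ : Poly → Poly → Poly
[]      +ₚ q       = q
(a ∷ p) +ₚ []      = a ∷ p
(a ∷ p) +ₚ (b ∷ q) = (a +ℤ b) ∷ (p +ₚ q)

infixl 7 _*ₚ_
_*ₚ_ : Poly → Poly → Poly
[]      *ₚ q = []
(a ∷ p) *ₚ q = map (a *ℤ_) q +ₚ (0ℤ ∷ (p *ₚ q))

-ₚ_ : Poly → Poly
-ₚ p = map -ℤ_ p

oneₚ : Poly
oneₚ = 1ℤ ∷ []

x-1 : Poly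
x-1 = -1ℤ ∷ 1ℤ ∷ []

sumₚ : List Poly → Poly
sumₚ = foldr _+ₚ_ []

DegLe : Poly → ℕ → Set
DegLe p n = ∀ k → n <ℕ k → coeff p k ≡ 0ℤ

-- x^n p(x⁻¹): coefficient of x^k is coeff p (n - k) for k ≤ n.
-- (Agrees with the Laurent polynomial x^n p(x⁻¹) whenever deg p ≤ n.)
revₙ : ℕ → Poly → Poly
revₙ n p = map (λ k → coeff p (n ∸ k)) (upTo (suc n))

record LFPoset : Set₁ where
  field
    Carrier   : Set
    _≤_       : Carrier → Carrier → Set
    isPartialOrder : IsPartialOrder _≡_ _≤_
    interval  : Carrier → Carrier → List Carrier
    interval-spec   : ∀ s w t → (w ∈ interval s t) ⇔ (s ≤ w × w ≤ t)
    interval-unique : ∀ s t → Unique (interval s t)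

  _<_ : Carrier → Carrier → Set
  s < t = s ≤ t × s ≢ t

module _ (P : LFPoset) where
  open LFPoset P

  -- weak rank function ρ : Int(P) → ℕ  (only values on intervals matter)
  IsWeakRank : (Carrier → Carrier → ℕ) → Set
  IsWeakRank ρ =
    (∀ s t → s < t → 0 <ℕ ρ s t) ×
    (∀ s w t → s ≤ w → w ≤ t → ρ s t ≡ ρ s w + ρ w t)

  -- elements of the incidence algebra I(P): a s t is meaningful for s ≤ t
  Inc : Set
  Inc = Carrier → Carrier → Poly

  infix 4 _≈ᵢ_
  _≈ᵢ_ : Inc → Inc → Set
  a ≈ᵢ b = ∀ s t → s ≤ t → a s t ≈ₚ b s t

  infixl 7 _⊛_
  _⊛_ : Inc → Inc → Inc
  (a ⊛ b) s t = sumₚ (map (λ w → a s w *ₚ b w t) (interval s t))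

  -ᵢ_ : Inc → Inc
  (-ᵢ a) s t = -ₚ (a s t)

  IsIdentity : Inc → Set
  IsIdentity a = (∀ s → a s s ≈ₚ oneₚ) × (∀ s t → s < t → a s t ≈ₚ [])

  IsInverse : Inc → Inc → Set
  IsInverse a b = IsIdentity (a ⊛ b) × IsIdentity (b ⊛ a)

  module _ (ρ : Carrier → Carrier → ℕ) where

    InIρ : Inc → Set
    InIρ a = ∀ s t → s ≤ t → DegLe (a s t) (ρ s t)

    rev : Inc → Inc
    rev a s t = revₙ (ρ s t) (a s t)

    IsKernel : Inc → Set
    IsKernel κ = InIρ κ × (∀ s → κ s s ≈ₚ oneₚ) × IsInverse κ (rev κ)

    IsReducedKernel : Inc → Inc → Set
    IsReducedKernel κ κ̄ =
      (∀ s → κ̄ s s ≈ₚ (-1ℤ ∷ [])) ×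
      (∀ s t → s < t → x-1 *ₚ κ̄ s t ≈ₚ κ s t)

    IsChowFunction : Inc → Inc → Set
    IsChowFunction κ H = Σ Inc λ κ̄ → IsReducedKernel κ κ̄ × IsInverse κ̄ (-ᵢ H)

    CondI : Inc → Set
    CondI H = ∀ s → H s s ≈ₚ oneₚ

    CondII : Inc → Set
    CondII H = ∀ s t → s < t → H s t ≈ₚ revₙ (ρ s t ∸ 1) (H s t)

{-# OPTIONS --safe #-}

-- Write κ = (x - 1)κ̄ + xδ.  If G_ss = 1, condition (ii) says exactly that
-- G^rev = xG - (x - 1)δ, and then κG = G^rev amounts to (x - 1)(κ̄G + δ) = 0, i.e. to
-- κ̄G = -δ, which forces G = -κ̄⁻¹ = H; the same works on the right.  So it remains to
-- show that H satisfies (ii).  As the inverse of a unitriangular element of I_ρ, H lies in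
-- I_ρ, where reversal is multiplicative, so reversing κ̄H = -δ gives κ̄^rev H^rev = -δ.
-- Multiplying κκ^rev = δ by x and using xκ^rev = δ - (x - 1)κ̄^rev yields
-- κ̄ = xκ̄^rev + (x - 1)κ̄κ̄^rev; hence κ̄H^rev = -xδ - (x - 1)κ̄, and multiplying on the
-- left by -H gives H^rev = xH - (x - 1)δ.

module Submission where

open import Algebra.Bundles using (CommutativeRing; CommutativeSemigroup)
import Algebra.Properties.AbelianGroup as AbelianGroupProperties
import Algebra.Properties.CommutativeSemigroup as CommutativeSemigroupProperties
import Algebra.Properties.Group as GroupProperties
import Algebra.Properties.Ring as RingProperties
open import Data.Empty using (⊥-elim)
open import Data.Integer using (ℤ; 0ℤ; 1ℤ; -1ℤ) renaming (_+_ to _+ℤ_; _*_ to _*ℤ_; -_ to -ℤ_)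
import Data.Integer.Properties as ℤ
open import Data.List using (List; []; _∷_; map; _++_; concatMap; length; applyUpTo)
open import Data.List.Properties using (map-∘)
open import Data.List.Membership.Propositional using (_∈_)
open import Data.List.Membership.Propositional.Properties using (∈-map⁺; ∈-map⁻; ∈-++⁺ˡ; ∈-++⁺ʳ; ∈-++⁻)
open import Data.List.Membership.Propositional.Properties.WithK using (unique∧set⇒bag)
open import Data.List.Relation.Binary.BagAndSetEquality using (∼bag⇒↭)
open import Data.List.Relation.Binary.Permutation.Propositional using (_↭_; ↭⇒↭ₛ′)
import Data.List.Relation.Binary.Permutation.Propositional.Properties as ↭
import Data.List.Relation.Binary.Permutation.Setoid.Properties as ↭ₛ
open import Data.List.Relation.Unary.All as All using (_∷_)
open import Data.List.Relation.Unary.Any using (here; there)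
open import Data.List.Relation.Unary.Unique.Propositional using (Unique; []; _∷_)
import Data.List.Relation.Unary.Unique.Propositional.Properties as Unique
open import Data.Maybe using (Maybe; just; nothing)
open import Data.Nat using (ℕ; zero; suc; _∸_; z≤n; s≤s) renaming (_+_ to _+ℕ_; _≤_ to _≤ℕ_; _<_ to _<ℕ_)
open import Data.Nat.Induction using (<-rec)
import Data.Nat.Properties as ℕ
open import Data.Product using (_×_; _,_; proj₁; proj₂; swap; uncurry; ∃)
open import Data.Sum as Sum using (_⊎_; inj₁; inj₂; [_,_]′)
open import Function using (_∘_)
open import Function.Bundles using (_⇔_; mk⇔; Equivalence)
open import Level using (0ℓ)
open import Relation.Binary.Bundles using (Setoid)
open import Relation.Binary.PropositionalEquality
  using (_≡_; _≢_; ≢-sym; refl; sym; trans; cong; cong₂; subst; module ≡-Reasoning)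
import Relation.Binary.Reasoning.Setoid as SetoidReasoning
open import Relation.Binary.Structures using (IsEquivalence; IsPartialOrder)
open import Relation.Nullary using (¬_; yes; no)
open import Tactic.RingSolver using (solve-∀)
open import Tactic.RingSolver.Core.AlmostCommutativeRing using (AlmostCommutativeRing; fromCommutativeRing)

open import Defs

-- The ring ℤ[x]

-- The coefficientwise equality of Defs, wrapped in a record so that the polynomials can be
-- inferred from it; degree bounds and equality in I(P) are wrapped in the same way below.
infix 4 _≃_
record _≃_ (p q : Poly) : Set where
  constructor coeffwise
  field coeff-≡ : p ≈ₚ q
open _≃_ public

≃-refl : ∀ {p} → p ≃ p
≃-refl = coeffwise λ _ → refl

≃-sym : ∀ {p q} → p ≃ q → q ≃ p
≃-sym (coeffwise e) = coeffwise (sym ∘ e)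

≃-trans : ∀ {p q r} → p ≃ q → q ≃ r → p ≃ r
≃-trans (coeffwise e) (coeffwise f) = coeffwise λ k → trans (e k) (f k)

infixl 7 _·_
_·_ : ℤ → Poly → Poly
a · p = map (a *ℤ_) p

coeff-+ : ∀ p q k → coeff (p +ₚ q) k ≡ coeff p k +ℤ coeff q k
coeff-+ []      q       k       = sym (ℤ.+-identityˡ _)
coeff-+ (a ∷ p) []      k       = sym (ℤ.+-identityʳ _)
coeff-+ (a ∷ p) (b ∷ q) zero    = refl
coeff-+ (a ∷ p) (b ∷ q) (suc k) = coeff-+ p q k

coeff-map : ∀ (f : ℤ → ℤ) → f 0ℤ ≡ 0ℤ → ∀ p k → coeff (map f p) k ≡ f (coeff p k)
coeff-map f f0 []      k       = sym f0
coeff-map f f0 (a ∷ p) zero    = refl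
coeff-map f f0 (a ∷ p) (suc k) = coeff-map f f0 p k

coeff-· : ∀ a p k → coeff (a · p) k ≡ a *ℤ coeff p k
coeff-· a = coeff-map (a *ℤ_) (ℤ.*-zeroʳ a)

coeff-neg : ∀ p k → coeff (-ₚ p) k ≡ -ℤ coeff p k
coeff-neg = coeff-map -ℤ_ refl

[0]≃[] : 0ℤ ∷ [] ≃ []
[0]≃[] = coeffwise λ { zero → refl ; (suc k) → refl }

∷-cong : ∀ {a b p q} → a ≡ b → p ≃ q → a ∷ p ≃ b ∷ q
∷-cong a≡b (coeffwise e) = coeffwise λ { zero → a≡b ; (suc k) → e k }

+-cong : ∀ {p p′ q q′} → p ≃ p′ → q ≃ q′ → p +ₚ q ≃ p′ +ₚ q′
+-cong {p} {p′} {q} {q′} (coeffwise e) (coeffwise f) = coeffwise λ k →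
  trans (coeff-+ p q k) (trans (cong₂ _+ℤ_ (e k) (f k)) (sym (coeff-+ p′ q′ k)))

+-comm : ∀ p q → p +ₚ q ≃ q +ₚ p
+-comm p q = coeffwise λ k →
  trans (coeff-+ p q k) (trans (ℤ.+-comm (coeff p k) (coeff q k)) (sym (coeff-+ q p k)))

+-assoc : ∀ p q r → (p +ₚ q) +ₚ r ≃ p +ₚ (q +ₚ r)
+-assoc p q r = coeffwise λ k → begin
  coeff ((p +ₚ q) +ₚ r) k                ≡⟨ trans (coeff-+ (p +ₚ q) r k) (cong (_+ℤ coeff r k) (coeff-+ p q k)) ⟩
  (coeff p k +ℤ coeff q k) +ℤ coeff r k  ≡⟨ ℤ.+-assoc (coeff p k) (coeff q k) (coeff r k) ⟩
  coeff p k +ℤ (coeff q k +ℤ coeff r k)  ≡⟨ trans (coeff-+ p (q +ₚ r) k) (cong (coeff p k +ℤ_) (coeff-+ q r k)) ⟨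
  coeff (p +ₚ (q +ₚ r)) k                ∎
  where open ≡-Reasoning

+-identityʳ : ∀ p → p +ₚ [] ≃ p
+-identityʳ p = coeffwise λ k → trans (coeff-+ p [] k) (ℤ.+-identityʳ (coeff p k))

-‿inverseʳ : ∀ p → p +ₚ -ₚ p ≃ []
-‿inverseʳ p = coeffwise λ k →
  trans (coeff-+ p (-ₚ p) k) (trans (cong (coeff p k +ℤ_) (coeff-neg p k)) (ℤ.+-inverseʳ (coeff p k)))

-‿cong : ∀ {p q} → p ≃ q → -ₚ p ≃ -ₚ q
-‿cong {p} {q} (coeffwise e) = coeffwise λ k →
  trans (coeff-neg p k) (trans (cong -ℤ_ (e k)) (sym (coeff-neg q k)))

·-cong : ∀ a {p q} → p ≃ q → a · p ≃ a · q
·-cong a {p} {q} (coeffwise e) = coeffwise λ k →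
  trans (coeff-· a p k) (trans (cong (a *ℤ_) (e k)) (sym (coeff-· a q k)))

·-distrib-+ : ∀ a p q → a · (p +ₚ q) ≃ a · p +ₚ a · q
·-distrib-+ a p q = coeffwise λ k → begin
  coeff (a · (p +ₚ q)) k
    ≡⟨ trans (coeff-· a (p +ₚ q) k) (cong (a *ℤ_) (coeff-+ p q k)) ⟩
  a *ℤ (coeff p k +ℤ coeff q k)
    ≡⟨ ℤ.*-distribˡ-+ a _ _ ⟩
  a *ℤ coeff p k +ℤ a *ℤ coeff q k
    ≡⟨ trans (coeff-+ (a · p) (a · q) k) (cong₂ _+ℤ_ (coeff-· a p k) (coeff-· a q k)) ⟨
  coeff (a · p +ₚ a · q) k
    ∎
  where open ≡-Reasoning

+-distrib-· : ∀ a b p → (a +ℤ b) · p ≃ a · p +ₚ b · p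
+-distrib-· a b p = coeffwise λ k → begin
  coeff ((a +ℤ b) · p) k
    ≡⟨ coeff-· (a +ℤ b) p k ⟩
  (a +ℤ b) *ℤ coeff p k
    ≡⟨ ℤ.*-distribʳ-+ _ a b ⟩
  a *ℤ coeff p k +ℤ b *ℤ coeff p k
    ≡⟨ trans (coeff-+ (a · p) (b · p) k) (cong₂ _+ℤ_ (coeff-· a p k) (coeff-· b p k)) ⟨
  coeff (a · p +ₚ b · p) k
    ∎
  where open ≡-Reasoning

·-assoc : ∀ a b p → a · (b · p) ≃ (a *ℤ b) · p
·-assoc a b p = coeffwise λ k →
  trans (coeff-· a (b · p) k) (trans (cong (a *ℤ_) (coeff-· b p k))
    (trans (sym (ℤ.*-assoc a b _)) (sym (coeff-· (a *ℤ b) p k))))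

0·p≃0 : ∀ p → 0ℤ · p ≃ []
0·p≃0 p = coeffwise λ k → trans (coeff-· 0ℤ p k) (ℤ.*-zeroˡ (coeff p k))

1·p≃p : ∀ p → 1ℤ · p ≃ p
1·p≃p p = coeffwise λ k → trans (coeff-· 1ℤ p k) (ℤ.*-identityˡ (coeff p k))

≃-isEquivalence : IsEquivalence _≃_
≃-isEquivalence = record { refl = ≃-refl ; sym = ≃-sym ; trans = ≃-trans }

+-commutativeSemigroup : CommutativeSemigroup 0ℓ 0ℓ
+-commutativeSemigroup = record
  { _≈_ = _≃_ ; _∙_ = _+ₚ_
  ; isCommutativeSemigroup = record
    { isSemigroup = record
      { isMagma = record { isEquivalence = ≃-isEquivalence ; ∙-cong = +-cong }
      ; assoc = +-assoc }
    ; comm = +-comm } }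

open CommutativeSemigroupProperties +-commutativeSemigroup
  using () renaming (interchange to +-interchange; x∙yz≈y∙xz to x+[y+z]≃y+[x+z])

*-zeroʳ : ∀ p → p *ₚ [] ≃ []
*-zeroʳ []      = ≃-refl
*-zeroʳ (a ∷ p) = coeffwise λ { zero → refl ; (suc k) → coeff-≡ (*-zeroʳ p) k }

*-congˡ : ∀ p {q q′} → q ≃ q′ → p *ₚ q ≃ p *ₚ q′
*-congˡ []      q≃q′ = ≃-refl
*-congˡ (a ∷ p) q≃q′ = +-cong (·-cong a q≃q′) (∷-cong refl (*-congˡ p q≃q′))

*-distribʳ : ∀ p q r → (p +ₚ q) *ₚ r ≃ p *ₚ r +ₚ q *ₚ r
*-distribʳ []      q       r = ≃-refl
*-distribʳ (a ∷ p) []      r = ≃-sym (+-identityʳ _)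
*-distribʳ (a ∷ p) (b ∷ q) r = ≃-trans
  (+-cong (+-distrib-· a b r) (∷-cong refl (*-distribʳ p q r)))
  (+-interchange (a · r) (b · r) (0ℤ ∷ p *ₚ r) (0ℤ ∷ q *ₚ r))

*-∷ʳ : ∀ q a p → q *ₚ (a ∷ p) ≃ a · q +ₚ (0ℤ ∷ q *ₚ p)
*-∷ʳ []      a p = ≃-sym [0]≃[]
*-∷ʳ (b ∷ q) a p = ≃-trans (+-cong (≃-refl {b · (a ∷ p)}) (∷-cong refl (*-∷ʳ q a p)))
  (∷-cong (cong (_+ℤ 0ℤ) (ℤ.*-comm b a)) (x+[y+z]≃y+[x+z] (b · p) (a · q) (0ℤ ∷ q *ₚ p)))

*-comm : ∀ p q → p *ₚ q ≃ q *ₚ p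
*-comm []      q = ≃-sym (*-zeroʳ q)
*-comm (a ∷ p) q = ≃-trans (+-cong (≃-refl {a · q}) (∷-cong refl (*-comm p q))) (≃-sym (*-∷ʳ q a p))

·-* : ∀ a p q → (a · p) *ₚ q ≃ a · (p *ₚ q)
·-* a []      q = ≃-refl
·-* a (b ∷ p) q = ≃-trans
  (+-cong (≃-sym (·-assoc a b q)) (∷-cong (sym (ℤ.*-zeroʳ a)) (·-* a p q)))
  (≃-sym (·-distrib-+ a (b · q) (0ℤ ∷ p *ₚ q)))

∷-* : ∀ p q → (0ℤ ∷ p) *ₚ q ≃ 0ℤ ∷ p *ₚ q
∷-* p q = +-cong (0·p≃0 q) ≃-refl

*-assoc : ∀ p q r → (p *ₚ q) *ₚ r ≃ p *ₚ (q *ₚ r)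
*-assoc []      q r = ≃-refl
*-assoc (a ∷ p) q r = ≃-trans (*-distribʳ (a · q) (0ℤ ∷ p *ₚ q) r)
  (+-cong (·-* a q r) (≃-trans (∷-* (p *ₚ q) r) (∷-cong refl (*-assoc p q r))))

*-identityˡ : ∀ p → oneₚ *ₚ p ≃ p
*-identityˡ p = ≃-trans (+-cong (1·p≃p p) [0]≃[]) (+-identityʳ p)

*-congʳ : ∀ r {p p′} → p ≃ p′ → p *ₚ r ≃ p′ *ₚ r
*-congʳ r {p} {p′} p≃p′ = ≃-trans (*-comm p r) (≃-trans (*-congˡ r p≃p′) (*-comm r p′))

ℤ[x] : CommutativeRing 0ℓ 0ℓ
ℤ[x] = record
  { Carrier = Poly ; _≈_ = _≃_ ; _+_ = _+ₚ_ ; _*_ = _*ₚ_ ; -_ = -ₚ_ ; 0# = [] ; 1# = oneₚ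
  ; isCommutativeRing = record
    { isRing = record
      { +-isAbelianGroup = record
        { isGroup = record
          { isMonoid = record
            { isSemigroup = record
              { isMagma = record { isEquivalence = ≃-isEquivalence ; ∙-cong = +-cong }
              ; assoc = +-assoc }
            ; identity = (λ _ → ≃-refl) , +-identityʳ }
          ; inverse = (λ p → ≃-trans (+-comm (-ₚ p) p) (-‿inverseʳ p)) , -‿inverseʳ
          ; ⁻¹-cong = -‿cong }
        ; comm = +-comm }
      ; *-cong = λ {p} {p′} {q} {q′} p≃p′ q≃q′ → ≃-trans (*-congˡ p q≃q′) (*-congʳ q′ p≃p′)
      ; *-assoc = *-assoc
      ; *-identity = *-identityˡ , λ p → ≃-trans (*-comm p oneₚ) (*-identityˡ p)
      ; distrib = (λ p q r → ≃-trans (*-comm p (q +ₚ r))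
                                (≃-trans (*-distribʳ q r p) (+-cong (*-comm q p) (*-comm r p))))
                , (λ p q r → *-distribʳ q r p) }
    ; *-comm = *-comm } }

module ℤ[x] = CommutativeRing ℤ[x]
open GroupProperties ℤ[x].+-group using (x∙y⁻¹≈ε⇒x≈y; //-rightDividesʳ) renaming (∙-cancelʳ to +-cancelʳ)
open AbelianGroupProperties ℤ[x].+-abelianGroup using (xyx⁻¹≈y)
open RingProperties ℤ[x].ring using (-1*x≈-x; -‿involutive)
open CommutativeSemigroupProperties ℤ[x].*-commutativeSemigroup using () renaming (x∙yz≈y∙xz to x*[y*z]≃y*[x*z])

module ≃-Reasoning = SetoidReasoning ℤ[x].setoid

-- Lets the ring solver discard coefficients that are the zero polynomial.
≟[] : ∀ p → Maybe ([] ≃ p)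
≟[] []      = just ≃-refl
≟[] (a ∷ p) with a ℤ.≟ 0ℤ | ≟[] p
... | yes refl | just []≃p = just (coeffwise λ { zero → refl ; (suc k) → coeff-≡ []≃p k })
... | _        | _         = nothing

ℤ[x]-solver : AlmostCommutativeRing _ _
ℤ[x]-solver = fromCommutativeRing ℤ[x] ≟[]

-- The indeterminate, spelled so that the ring solver sees it as (x - 1) + 1.
x : Poly
x = x-1 +ₚ oneₚ

oneₚ-split : oneₚ ≃ x-1 *ₚ -ₚ oneₚ +ₚ x *ₚ oneₚ
oneₚ-split = identity x-1
  where
  identity : ∀ m → oneₚ ≃ m *ₚ -ₚ oneₚ +ₚ (m +ₚ oneₚ) *ₚ oneₚ
  identity = solve-∀ ℤ[x]-solver

x*p≃0∷p : ∀ p → x *ₚ p ≃ 0ℤ ∷ p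
x*p≃0∷p p = +-cong (0·p≃0 p) (∷-cong refl (*-identityˡ p))

x-1*p≃0∷p-p : ∀ p → x-1 *ₚ p ≃ (0ℤ ∷ p) +ₚ -ₚ p
x-1*p≃0∷p-p p = ≃-trans (expand x p) (+-cong (x*p≃0∷p p) ≃-refl)
  where
  -- x +ₚ -ₚ oneₚ normalises to x-1.
  expand : ∀ y p → (y +ₚ -ₚ oneₚ) *ₚ p ≃ y *ₚ p +ₚ -ₚ p
  expand = solve-∀ ℤ[x]-solver

coeff-x-1* : ∀ p k → coeff (x-1 *ₚ p) k ≡ coeff (0ℤ ∷ p) k +ℤ -ℤ coeff p k
coeff-x-1* p k = trans (coeff-≡ (x-1*p≃0∷p-p p) k)
  (trans (coeff-+ (0ℤ ∷ p) (-ₚ p) k) (cong (coeff (0ℤ ∷ p) k +ℤ_) (coeff-neg p k)))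

x-1*-coeff-step : ∀ p k → coeff (x-1 *ₚ p) (suc k) ≡ 0ℤ → coeff p k ≡ coeff p (suc k)
x-1*-coeff-step p k e = ℤ.i-j≡0⇒i≡j (coeff p k) (coeff p (suc k)) (trans (sym (coeff-x-1* p (suc k))) e)

x-1*-cancel : ∀ {p} → x-1 *ₚ p ≃ [] → p ≃ []
x-1*-cancel {p} (coeffwise e) = coeffwise vanish
  where
  vanish : ∀ k → coeff p k ≡ 0ℤ
  vanish zero    = sym (ℤ.i-j≡0⇒i≡j 0ℤ (coeff p 0) (trans (sym (coeff-x-1* p 0)) (e 0)))
  vanish (suc k) = trans (sym (x-1*-coeff-step p k (e (suc k)))) (vanish k)

-- Degree bounds

record Deg≤ (p : Poly) (n : ℕ) : Set where
  constructor deg≤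
  field vanish : DegLe p n
open Deg≤ public

Deg≤-cong : ∀ {p q n} → p ≃ q → Deg≤ p n → Deg≤ q n
Deg≤-cong (coeffwise e) (deg≤ d) = deg≤ λ k n<k → trans (sym (e k)) (d k n<k)

Deg≤-mono : ∀ {p m n} → m ≤ℕ n → Deg≤ p m → Deg≤ p n
Deg≤-mono m≤n (deg≤ d) = deg≤ λ k n<k → d k (ℕ.≤-<-trans m≤n n<k)

Deg≤-[] : ∀ {n} → Deg≤ [] n
Deg≤-[] = deg≤ λ _ _ → refl

Deg≤-const : ∀ a {n} → Deg≤ (a ∷ []) n
Deg≤-const a = deg≤ λ { (suc k) _ → refl }

Deg≤-+ : ∀ {p q n} → Deg≤ p n → Deg≤ q n → Deg≤ (p +ₚ q) n
Deg≤-+ {p} {q} (deg≤ dp) (deg≤ dq) = deg≤ λ k n<k → trans (coeff-+ p q k) (cong₂ _+ℤ_ (dp k n<k) (dq k n<k))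

Deg≤-· : ∀ a {p n} → Deg≤ p n → Deg≤ (a · p) n
Deg≤-· a {p} (deg≤ d) = deg≤ λ k n<k → trans (coeff-· a p k) (trans (cong (a *ℤ_) (d k n<k)) (ℤ.*-zeroʳ a))

Deg≤-neg : ∀ {p n} → Deg≤ p n → Deg≤ (-ₚ p) n
Deg≤-neg {p} (deg≤ d) = deg≤ λ k n<k → trans (coeff-neg p k) (cong -ℤ_ (d k n<k))

Deg≤-∷⁺ : ∀ {p n} → Deg≤ p n → Deg≤ (0ℤ ∷ p) (suc n)
Deg≤-∷⁺ (deg≤ d) = deg≤ λ { (suc k) (s≤s n<k) → d k n<k }

Deg≤-∷⁻ : ∀ {a p n} → Deg≤ (a ∷ p) (suc n) → Deg≤ p n
Deg≤-∷⁻ (deg≤ d) = deg≤ λ k n<k → d (suc k) (s≤s n<k)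

Deg≤0⇒const : ∀ {a p} → Deg≤ (a ∷ p) 0 → a ∷ p ≃ a ∷ []
Deg≤0⇒const (deg≤ d) = coeffwise λ { zero → refl ; (suc k) → d (suc k) (s≤s z≤n) }

Deg≤-* : ∀ {p q m n} → Deg≤ p m → Deg≤ q n → Deg≤ (p *ₚ q) (m +ℕ n)
Deg≤-* {[]}                    dp dq = Deg≤-[]
Deg≤-* {a ∷ p} {q} {zero}  {n} dp dq =
  Deg≤-cong (*-congʳ q (≃-sym (Deg≤0⇒const dp))) (Deg≤-+ (Deg≤-· a dq) (Deg≤-const 0ℤ))
Deg≤-* {a ∷ p} {q} {suc m} {n} dp dq =
  Deg≤-+ (Deg≤-mono (ℕ.m≤n⇒m≤1+n (ℕ.m≤n+m n m)) (Deg≤-· a dq)) (Deg≤-∷⁺ (Deg≤-* (Deg≤-∷⁻ dp) dq))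

coeff-≥length : ∀ p {k} → length p ≤ℕ k → coeff p k ≡ 0ℤ
coeff-≥length []      _         = refl
coeff-≥length (a ∷ p) (s≤s len≤k) = coeff-≥length p len≤k

Deg≤-x-1*⁻ : ∀ {p n} → Deg≤ (x-1 *ₚ p) (suc n) → Deg≤ p n
Deg≤-x-1*⁻ {p} {n} (deg≤ d) = deg≤ λ k n<k → trans (constant (length p) k n<k) (coeff-≥length p (ℕ.m≤m+n (length p) k))
  where
  constant : ∀ j k → n <ℕ k → coeff p k ≡ coeff p (j +ℕ k)
  constant zero    k n<k = refl
  constant (suc j) k n<k = trans (x-1*-coeff-step p k (d (suc k) (s≤s n<k)))
    (trans (constant j (suc k) (ℕ.m≤n⇒m≤1+n n<k)) (cong (coeff p) (ℕ.+-suc j k)))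

-- Reversal

coeff-map-applyUpTo-< : ∀ (g : ℕ → ℤ) f {m k} → k <ℕ m → coeff (map g (applyUpTo f m)) k ≡ g (f k)
coeff-map-applyUpTo-< g f {suc m} {zero}  _           = refl
coeff-map-applyUpTo-< g f {suc m} {suc k} (s≤s k<m)   = coeff-map-applyUpTo-< g (f ∘ suc) k<m

coeff-map-applyUpTo-≥ : ∀ (g : ℕ → ℤ) f {m k} → m ≤ℕ k → coeff (map g (applyUpTo f m)) k ≡ 0ℤ
coeff-map-applyUpTo-≥ g f {zero}              _         = refl
coeff-map-applyUpTo-≥ g f {suc m} {suc k} (s≤s m≤k) = coeff-map-applyUpTo-≥ g (f ∘ suc) m≤k

coeff-revₙ : ∀ {n k} p → k ≤ℕ n → coeff (revₙ n p) k ≡ coeff p (n ∸ k)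
coeff-revₙ {n} p k≤n = coeff-map-applyUpTo-< (λ k → coeff p (n ∸ k)) (λ k → k) (s≤s k≤n)

Deg≤-revₙ : ∀ n p → Deg≤ (revₙ n p) n
Deg≤-revₙ n p = deg≤ λ k n<k → coeff-map-applyUpTo-≥ (λ k → coeff p (n ∸ k)) (λ k → k) n<k

revₙ-unique : ∀ {n} p {r} → (∀ {k} → k ≤ℕ n → coeff r k ≡ coeff p (n ∸ k)) → Deg≤ r n → revₙ n p ≃ r
revₙ-unique {n} p {r} e (deg≤ d) = coeffwise λ k → compare k
  where
  compare : ∀ k → coeff (revₙ n p) k ≡ coeff r k
  compare k with k ℕ.≤? n
  ... | yes k≤n = trans (coeff-revₙ p k≤n) (sym (e k≤n))
  ... | no  k≰n = trans (vanish (Deg≤-revₙ n p) k (ℕ.≰⇒> k≰n)) (sym (d k (ℕ.≰⇒> k≰n)))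

revₙ-cong : ∀ {n p q} → p ≃ q → revₙ n p ≃ revₙ n q
revₙ-cong {n} {p} {q} (coeffwise e) =
  revₙ-unique p (λ k≤n → trans (coeff-revₙ q k≤n) (sym (e _))) (Deg≤-revₙ n q)

revₙ-+ : ∀ n p q → revₙ n (p +ₚ q) ≃ revₙ n p +ₚ revₙ n q
revₙ-+ n p q = revₙ-unique (p +ₚ q)
  (λ {k} k≤n → trans (coeff-+ (revₙ n p) (revₙ n q) k)
    (trans (cong₂ _+ℤ_ (coeff-revₙ p k≤n) (coeff-revₙ q k≤n)) (sym (coeff-+ p q (n ∸ k)))))
  (Deg≤-+ (Deg≤-revₙ n p) (Deg≤-revₙ n q))

revₙ-· : ∀ n a p → revₙ n (a · p) ≃ a · revₙ n p
revₙ-· n a p = revₙ-unique (a · p)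
  (λ {k} k≤n → trans (coeff-· a (revₙ n p) k)
    (trans (cong (a *ℤ_) (coeff-revₙ p k≤n)) (sym (coeff-· a p (n ∸ k)))))
  (Deg≤-· a (Deg≤-revₙ n p))

revₙ-neg : ∀ n p → revₙ n (-ₚ p) ≃ -ₚ revₙ n p
revₙ-neg n p = revₙ-unique (-ₚ p)
  (λ {k} k≤n → trans (coeff-neg (revₙ n p) k)
    (trans (cong -ℤ_ (coeff-revₙ p k≤n)) (sym (coeff-neg p (n ∸ k)))))
  (Deg≤-neg (Deg≤-revₙ n p))

revₙ-[] : ∀ n → revₙ n [] ≃ []
revₙ-[] n = revₙ-unique [] (λ _ → refl) Deg≤-[]

revₙ-∷ : ∀ n p → revₙ (suc n) (0ℤ ∷ p) ≃ revₙ n p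
revₙ-∷ n p = revₙ-unique (0ℤ ∷ p) shifted (Deg≤-mono (ℕ.n≤1+n n) (Deg≤-revₙ n p))
  where
  shifted : ∀ {k} → k ≤ℕ suc n → coeff (revₙ n p) k ≡ coeff (0ℤ ∷ p) (suc n ∸ k)
  shifted {k} k≤1+n with k ℕ.≤? n
  ... | yes k≤n = trans (coeff-revₙ p k≤n) (cong (coeff (0ℤ ∷ p)) (sym (ℕ.+-∸-assoc 1 k≤n)))
  ... | no  k≰n rewrite ℕ.≤-antisym k≤1+n (ℕ.≰⇒> k≰n) | ℕ.n∸n≡0 n =
    vanish (Deg≤-revₙ n p) (suc n) (ℕ.n<1+n n)

revₙ-shift : ∀ {n p} → Deg≤ p n → revₙ (suc n) p ≃ 0ℤ ∷ revₙ n p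
revₙ-shift {n} {p} (deg≤ d) = revₙ-unique p shifted (Deg≤-∷⁺ (Deg≤-revₙ n p))
  where
  shifted : ∀ {k} → k ≤ℕ suc n → coeff (0ℤ ∷ revₙ n p) k ≡ coeff p (suc n ∸ k)
  shifted {zero}  _           = sym (d (suc n) (ℕ.n<1+n n))
  shifted {suc k} (s≤s k≤n)   = coeff-revₙ p k≤n

const-* : ∀ a r → (a ∷ []) *ₚ r ≃ a · r
const-* a r = ≃-trans (+-cong (≃-refl {a · r}) [0]≃[]) (+-identityʳ (a · r))

revₙ-·-split : ∀ a {q} m {n} → Deg≤ q n → revₙ (m +ℕ n) (a · q) ≃ revₙ m (a ∷ []) *ₚ revₙ n q
revₙ-·-split a {q} zero    {n} dq = ≃-trans (revₙ-· n a q) (≃-sym (const-* a (revₙ n q)))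
revₙ-·-split a {q} (suc m) {n} dq = begin
  revₙ (suc (m +ℕ n)) (a · q)               ≈⟨ revₙ-shift (Deg≤-mono (ℕ.m≤n+m n m) (Deg≤-· a dq)) ⟩
  0ℤ ∷ revₙ (m +ℕ n) (a · q)                ≈⟨ ∷-cong refl (revₙ-·-split a m dq) ⟩
  0ℤ ∷ revₙ m (a ∷ []) *ₚ revₙ n q          ≈⟨ ∷-* (revₙ m (a ∷ [])) (revₙ n q) ⟨
  (0ℤ ∷ revₙ m (a ∷ [])) *ₚ revₙ n q        ≈⟨ *-congʳ (revₙ n q) (revₙ-shift (Deg≤-const a {m})) ⟨
  revₙ (suc m) (a ∷ []) *ₚ revₙ n q         ∎
  where open ≃-Reasoning

revₙ-* : ∀ {p q m n} → Deg≤ p m → Deg≤ q n → revₙ (m +ℕ n) (p *ₚ q) ≃ revₙ m p *ₚ revₙ n q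
revₙ-* {[]}    {q} {m} {n} dp dq =
  ≃-trans (revₙ-[] (m +ℕ n)) (≃-sym (*-congʳ (revₙ n q) (revₙ-[] m)))
revₙ-* {a ∷ p} {q} {zero}  {n} dp dq = begin
  revₙ n ((a ∷ p) *ₚ q)                     ≈⟨ revₙ-cong (*-congʳ q (Deg≤0⇒const dp)) ⟩
  revₙ n ((a ∷ []) *ₚ q)                    ≈⟨ revₙ-cong (const-* a q) ⟩
  revₙ n (a · q)                            ≈⟨ revₙ-·-split a zero dq ⟩
  revₙ zero (a ∷ p) *ₚ revₙ n q             ∎
  where open ≃-Reasoning
revₙ-* {a ∷ p} {q} {suc m} {n} dp dq = begin
  revₙ (suc (m +ℕ n)) (a · q +ₚ (0ℤ ∷ p *ₚ q))
    ≈⟨ revₙ-+ (suc (m +ℕ n)) (a · q) (0ℤ ∷ p *ₚ q) ⟩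
  revₙ (suc m +ℕ n) (a · q) +ₚ revₙ (suc (m +ℕ n)) (0ℤ ∷ p *ₚ q)
    ≈⟨ +-cong (revₙ-·-split a (suc m) dq) (≃-trans (revₙ-∷ (m +ℕ n) (p *ₚ q)) (revₙ-* (Deg≤-∷⁻ dp) dq)) ⟩
  revₙ (suc m) (a ∷ []) *ₚ r +ₚ revₙ m p *ₚ r
    ≈⟨ *-distribʳ (revₙ (suc m) (a ∷ [])) (revₙ m p) r ⟨
  (revₙ (suc m) (a ∷ []) +ₚ revₙ m p) *ₚ r
    ≈⟨ *-congʳ r (+-cong (≃-refl {revₙ (suc m) (a ∷ [])}) (revₙ-∷ m p)) ⟨
  (revₙ (suc m) (a ∷ []) +ₚ revₙ (suc m) (0ℤ ∷ p)) *ₚ r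
    ≈⟨ *-congʳ r (revₙ-+ (suc m) (a ∷ []) (0ℤ ∷ p)) ⟨
  revₙ (suc m) ((a +ℤ 0ℤ) ∷ p) *ₚ r
    ≈⟨ *-congʳ r (revₙ-cong (∷-cong (ℤ.+-identityʳ a) (≃-refl {p}))) ⟩
  revₙ (suc m) (a ∷ p) *ₚ r                 ∎
  where
  open ≃-Reasoning
  r : Poly
  r = revₙ n q

∷-injectiveʳ : ∀ {a b p q} → a ∷ p ≃ b ∷ q → p ≃ q
∷-injectiveʳ (coeffwise e) = coeffwise (e ∘ suc)

palindrome⇒revₙ-suc : ∀ {n p} → p ≃ revₙ n p → revₙ (suc n) p ≃ x *ₚ p
palindrome⇒revₙ-suc {n} {p} p≃rev = begin
  revₙ (suc n) p  ≈⟨ revₙ-shift (Deg≤-cong (≃-sym p≃rev) (Deg≤-revₙ n p)) ⟩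
  0ℤ ∷ revₙ n p   ≈⟨ ∷-cong refl p≃rev ⟨
  0ℤ ∷ p          ≈⟨ x*p≃0∷p p ⟨
  x *ₚ p          ∎
  where open ≃-Reasoning

revₙ-suc⇒palindrome : ∀ {n p} → revₙ (suc n) p ≃ x *ₚ p → p ≃ revₙ n p
revₙ-suc⇒palindrome {n} {p} rev≃xp = ∷-injectiveʳ (begin
  0ℤ ∷ p          ≈⟨ x*p≃0∷p p ⟨
  x *ₚ p          ≈⟨ rev≃xp ⟨
  revₙ (suc n) p  ≈⟨ revₙ-shift (Deg≤-∷⁻ (Deg≤-cong rev≃0∷p (Deg≤-revₙ (suc n) p))) ⟩
  0ℤ ∷ revₙ n p   ∎)
  where
  open ≃-Reasoning
  rev≃0∷p : revₙ (suc n) p ≃ 0ℤ ∷ p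
  rev≃0∷p = ≃-trans rev≃xp (x*p≃0∷p p)

Deg≤-x-1 : Deg≤ x-1 1
Deg≤-x-1 = deg≤ λ { (suc (suc k)) _ → refl ; (suc zero) (s≤s ()) }

revₙ-x-1* : ∀ {n p} → Deg≤ p n → revₙ (suc n) (x-1 *ₚ p) ≃ -ₚ x-1 *ₚ revₙ n p
revₙ-x-1* dp = revₙ-* Deg≤-x-1 dp

x-1*-injective : ∀ {p q} → x-1 *ₚ p ≃ x-1 *ₚ q → p ≃ q
x-1*-injective {p} {q} e = x∙y⁻¹≈ε⇒x≈y p q (x-1*-cancel (begin
  x-1 *ₚ (p +ₚ -ₚ q)             ≈⟨ expand x-1 p q ⟩
  x-1 *ₚ p +ₚ -ₚ (x-1 *ₚ q)      ≈⟨ +-cong e ≃-refl ⟩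
  x-1 *ₚ q +ₚ -ₚ (x-1 *ₚ q)      ≈⟨ -‿inverseʳ (x-1 *ₚ q) ⟩
  []                             ∎))
  where
  open ≃-Reasoning
  expand : ∀ m p q → m *ₚ (p +ₚ -ₚ q) ≃ m *ₚ p +ₚ -ₚ (m *ₚ q)
  expand = solve-∀ ℤ[x]-solver

-- Finite sums

module _ {A : Set} where

  ∑ : List A → (A → Poly) → Poly
  ∑ L f = sumₚ (map f L)

  ∑-cong : ∀ L {f g} → (∀ {y} → y ∈ L → f y ≃ g y) → ∑ L f ≃ ∑ L g
  ∑-cong []      f≃g = ≃-refl
  ∑-cong (y ∷ L) f≃g = +-cong (f≃g (here refl)) (∑-cong L (f≃g ∘ there))

  ∑-+ : ∀ L f g → ∑ L (λ y → f y +ₚ g y) ≃ ∑ L f +ₚ ∑ L g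
  ∑-+ []      f g = ≃-refl
  ∑-+ (y ∷ L) f g = ≃-trans (+-cong (≃-refl {f y +ₚ g y}) (∑-+ L f g)) (+-interchange (f y) (g y) (∑ L f) (∑ L g))

  ∑-*ʳ : ∀ L f c → ∑ L f *ₚ c ≃ ∑ L (λ y → f y *ₚ c)
  ∑-*ʳ []      f c = ≃-refl
  ∑-*ʳ (y ∷ L) f c = ≃-trans (*-distribʳ (f y) (∑ L f) c) (+-cong (≃-refl {f y *ₚ c}) (∑-*ʳ L f c))

  ∑-*ˡ : ∀ L f c → c *ₚ ∑ L f ≃ ∑ L (λ y → c *ₚ f y)
  ∑-*ˡ L f c = ≃-trans (*-comm c (∑ L f)) (≃-trans (∑-*ʳ L f c) (∑-cong L λ {y} _ → *-comm (f y) c))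

  revₙ-∑ : ∀ n L f → revₙ n (∑ L f) ≃ ∑ L (λ y → revₙ n (f y))
  revₙ-∑ n []      f = revₙ-[] n
  revₙ-∑ n (y ∷ L) f = ≃-trans (revₙ-+ n (f y) (∑ L f)) (+-cong (≃-refl {revₙ n (f y)}) (revₙ-∑ n L f))

  ∑-zero : ∀ L {f} → (∀ {y} → y ∈ L → f y ≃ []) → ∑ L f ≃ []
  ∑-zero []      f≃0 = ≃-refl
  ∑-zero (y ∷ L) f≃0 = +-cong (f≃0 (here refl)) (∑-zero L (f≃0 ∘ there))

  Deg≤-∑ : ∀ L {f n} → (∀ {y} → y ∈ L → Deg≤ (f y) n) → Deg≤ (∑ L f) n
  Deg≤-∑ []      d = Deg≤-[]
  Deg≤-∑ (y ∷ L) d = Deg≤-+ (d (here refl)) (Deg≤-∑ L (d ∘ there))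

  ∑-pick : ∀ {L f z} → z ∈ L → Unique L → (∀ {y} → y ∈ L → y ≢ z → f y ≃ []) → ∑ L f ≃ f z
  ∑-pick {y ∷ L} {f} (here refl) (y∉L ∷ _) others =
    ≃-trans (+-cong (≃-refl {f y}) (∑-zero L λ y′∈L → others (there y′∈L) (≢-sym (All.lookup y∉L y′∈L))))
            (+-identityʳ (f y))
  ∑-pick {y ∷ L} {f} (there z∈L) (y∉L ∷ u) others =
    +-cong (others (here refl) (All.lookup y∉L z∈L)) (∑-pick z∈L u (others ∘ there))

  Deg≤-∑-pick : ∀ {L f z n} → z ∈ L → Unique L → (∀ {y} → y ∈ L → y ≢ z → Deg≤ (f y) n) →
                Deg≤ (∑ L f) n → Deg≤ (f z) n
  Deg≤-∑-pick {y ∷ L} {f} (here refl) (y∉L ∷ _) others d =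
    Deg≤-cong (//-rightDividesʳ (∑ L f) (f y))
      (Deg≤-+ d (Deg≤-neg (Deg≤-∑ L λ y′∈L → others (there y′∈L) (≢-sym (All.lookup y∉L y′∈L)))))
  Deg≤-∑-pick {y ∷ L} {f} (there z∈L) (y∉L ∷ u) others d =
    Deg≤-∑-pick z∈L u (others ∘ there)
      (Deg≤-cong (xyx⁻¹≈y (f y) (∑ L f)) (Deg≤-+ d (Deg≤-neg (others (here refl) (All.lookup y∉L z∈L)))))

  ∑-++ : ∀ L M f → ∑ (L ++ M) f ≃ ∑ L f +ₚ ∑ M f
  ∑-++ []      M f = ≃-refl
  ∑-++ (y ∷ L) M f = ≃-trans (+-cong (≃-refl {f y}) (∑-++ L M f)) (≃-sym (+-assoc (f y) (∑ L f) (∑ M f)))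

  ∑-↭ : ∀ {L M} f → L ↭ M → ∑ L f ≃ ∑ M f
  ∑-↭ f L↭M = ↭ₛ.foldr-commMonoid ℤ[x].setoid ℤ[x].+-isCommutativeMonoid
    (↭⇒↭ₛ′ ℤ[x].isEquivalence (↭.map⁺ f L↭M))

∑-map : ∀ {A B : Set} (h : A → B) L f → ∑ (map h L) f ≡ ∑ L (f ∘ h)
∑-map h L f = cong sumₚ (sym (map-∘ L))

module _ {A B : Set} where

  pairs : List A → (A → List B) → List (A × B)
  pairs L g = concatMap (λ a → map (a ,_) (g a)) L

  ∈-pairs⁺ : ∀ {L g a b} → a ∈ L → b ∈ g a → (a , b) ∈ pairs L g
  ∈-pairs⁺ {y ∷ L} {g} (here refl) b∈ga = ∈-++⁺ˡ (∈-map⁺ (y ,_) b∈ga)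
  ∈-pairs⁺ {y ∷ L} {g} (there a∈L) b∈ga = ∈-++⁺ʳ (map (y ,_) (g y)) (∈-pairs⁺ a∈L b∈ga)

  ∈-pairs⁻ : ∀ {L g a b} → (a , b) ∈ pairs L g → a ∈ L × b ∈ g a
  ∈-pairs⁻ {y ∷ L} {g} ab∈ with ∈-++⁻ (map (y ,_) (g y)) ab∈
  ... | inj₁ ab∈head with ∈-map⁻ (y ,_) ab∈head
  ...   | b , b∈gy , refl = here refl , b∈gy
  ∈-pairs⁻ {y ∷ L} {g} ab∈ | inj₂ ab∈tail with ∈-pairs⁻ ab∈tail
  ...   | a∈L , b∈ga = there a∈L , b∈ga

  Unique-pairs : ∀ {L g} → Unique L → (∀ a → Unique (g a)) → Unique (pairs L g)
  Unique-pairs {[]}            []         ug = []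
  Unique-pairs {y ∷ L} {g} (y∉L ∷ uL) ug =
    Unique.++⁺ (Unique.map⁺ (cong proj₂) (ug y)) (Unique-pairs uL ug) disjoint
    where
    disjoint : ∀ {z} → ¬ (z ∈ map (y ,_) (g y) × z ∈ pairs L g)
    disjoint (z∈head , z∈tail) with ∈-map⁻ (y ,_) z∈head
    ... | _ , _ , refl = All.lookup y∉L (proj₁ (∈-pairs⁻ z∈tail)) refl

  ∑-pairs : ∀ L g F → ∑ (pairs L g) F ≃ ∑ L (λ a → ∑ (g a) (λ b → F (a , b)))
  ∑-pairs []      g F = ≃-refl
  ∑-pairs (y ∷ L) g F = ≃-trans (∑-++ (map (y ,_) (g y)) (pairs L g) F)
    (+-cong (ℤ[x].reflexive (∑-map (y ,_) (g y) F)) (∑-pairs L g F))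

∑-exchange : {A B : Set} {L : List A} {M : List B} {g : A → List B} {h : B → List A} →
  Unique L → Unique M → (∀ a → Unique (g a)) → (∀ b → Unique (h b)) →
  (∀ {a b} → (a ∈ L × b ∈ g a) ⇔ (b ∈ M × a ∈ h b)) → (F : A → B → Poly) →
  ∑ L (λ a → ∑ (g a) (F a)) ≃ ∑ M (λ b → ∑ (h b) (λ a → F a b))
∑-exchange {A} {B} {L} {M} {g} {h} uL uM ug uh same F = begin
  ∑ L (λ a → ∑ (g a) (F a))                  ≈⟨ ∑-pairs L g (uncurry F) ⟨
  ∑ (pairs L g) (uncurry F)                  ≈⟨ ∑-↭ (uncurry F) reorder ⟩
  ∑ (map swap (pairs M h)) (uncurry F)       ≡⟨ ∑-map swap (pairs M h) (uncurry F) ⟩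
  ∑ (pairs M h) (uncurry F ∘ swap)           ≈⟨ ∑-pairs M h (uncurry F ∘ swap) ⟩
  ∑ M (λ b → ∑ (h b) (λ a → F a b))          ∎
  where
  open ≃-Reasoning
  swapped : ∀ {z} → z ∈ pairs L g ⇔ z ∈ map swap (pairs M h)
  swapped {a , b} = mk⇔
    (λ ab∈ → ∈-map⁺ swap (uncurry ∈-pairs⁺ (Equivalence.to same (∈-pairs⁻ ab∈))))
    (λ ab∈ → from (∈-map⁻ swap ab∈))
    where
    from : ∃ (λ z → z ∈ pairs M h × (a , b) ≡ swap z) → (a , b) ∈ pairs L g
    from ((b , a) , ba∈ , refl) = uncurry ∈-pairs⁺ (Equivalence.from same (∈-pairs⁻ ba∈))
  reorder : pairs L g ↭ map swap (pairs M h)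
  reorder = ∼bag⇒↭ (unique∧set⇒bag (Unique-pairs uL ug)
    (Unique.map⁺ (λ {z z′} → swap-injective {z} {z′}) (Unique-pairs uM uh)) swapped)
    where
    swap-injective : ∀ {z z′ : B × A} → swap z ≡ swap z′ → z ≡ z′
    swap-injective refl = refl

module IncidenceAlgebra (P : LFPoset) where

  open LFPoset P
  open IsPartialOrder isPartialOrder public using () renaming (refl to ≤-refl; trans to ≤-trans; antisym to ≤-antisym)

  ∈-interval⁺ : ∀ {s w t} → s ≤ w → w ≤ t → w ∈ interval s t
  ∈-interval⁺ s≤w w≤t = Equivalence.from (interval-spec _ _ _) (s≤w , w≤t)

  ∈-interval⁻ : ∀ {s w t} → w ∈ interval s t → s ≤ w × w ≤ t
  ∈-interval⁻ = Equivalence.to (interval-spec _ _ _)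

  -- Without decidable equality on P, whether s = t is read off the duplicate-free list [s, t].
  ≤⇒≡⊎< : ∀ {s t} → s ≤ t → s ≡ t ⊎ s < t
  ≤⇒≡⊎< {s} {t} s≤t =
    shape (interval s t) (interval-unique s t) (∈-interval⁺ ≤-refl s≤t) (∈-interval⁺ s≤t ≤-refl) ∈-interval⁻
    where
    shape : ∀ L → Unique L → s ∈ L → t ∈ L → (∀ {w} → w ∈ L → s ≤ w × w ≤ t) → s ≡ t ⊎ s < t
    shape (y ∷ [])    _                    (here s≡y) (here t≡y) _      = inj₁ (trans s≡y (sym t≡y))
    shape (y ∷ z ∷ L) ((y≢z ∷ _) ∷ _) _          _          bounds =
      inj₂ (s≤t , λ s≡t → y≢z (trans (squeezed (here refl) s≡t) (sym (squeezed (there (here refl)) s≡t))))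
      where
      squeezed : ∀ {w} → w ∈ y ∷ z ∷ L → s ≡ t → w ≡ s
      squeezed w∈ refl = ≤-antisym (proj₂ (bounds w∈)) (proj₁ (bounds w∈))

  infix 4 _≃ᵢ_
  record _≃ᵢ_ (a b : Inc P) : Set where
    constructor on-intervals
    field at : ∀ {s t} → s ≤ t → a s t ≃ b s t
  open _≃ᵢ_ public

  ≈ᵢ⇒≃ᵢ : ∀ {a b} → _≈ᵢ_ P a b → a ≃ᵢ b
  ≈ᵢ⇒≃ᵢ a≈b = on-intervals λ s≤t → coeffwise (a≈b _ _ s≤t)

  ≃ᵢ⇒≈ᵢ : ∀ {a b} → a ≃ᵢ b → _≈ᵢ_ P a b
  ≃ᵢ⇒≈ᵢ a≃b _ _ s≤t = coeff-≡ (at a≃b s≤t)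

  ≃ᵢ-setoid : Setoid _ _
  ≃ᵢ-setoid = record
    { Carrier = Inc P ; _≈_ = _≃ᵢ_
    ; isEquivalence = record
      { refl  = on-intervals λ _ → ≃-refl
      ; sym   = λ a≃ᵢb → on-intervals (≃-sym ∘ at a≃ᵢb)
      ; trans = λ a≃ᵢb b≃ᵢc → on-intervals λ s≤t → ≃-trans (at a≃ᵢb s≤t) (at b≃ᵢc s≤t) } }

  open Setoid ≃ᵢ-setoid public using () renaming (refl to ≃ᵢ-refl; sym to ≃ᵢ-sym; trans to ≃ᵢ-trans)
  module ≃ᵢ-Reasoning = SetoidReasoning ≃ᵢ-setoid

  pointwise : ∀ {a b : Inc P} → (∀ s t → a s t ≃ b s t) → a ≃ᵢ b
  pointwise a≃b = on-intervals λ {s} {t} _ → a≃b s t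

  ≃ᵢ-by-cases : ∀ {a b : Inc P} → (∀ s → a s s ≃ b s s) → (∀ {s t} → s < t → a s t ≃ b s t) → a ≃ᵢ b
  ≃ᵢ-by-cases diagonal above = on-intervals λ s≤t → [ (λ { refl → diagonal _ }) , above ]′ (≤⇒≡⊎< s≤t)

  -- The intervals with exactly one element are the diagonal ones.
  δ : Inc P
  δ s t with interval s t
  ... | _ ∷ [] = oneₚ
  ... | _      = []

  δ-diagonal : ∀ s → δ s s ≃ oneₚ
  δ-diagonal s with interval s s | interval-unique s s | ∈-interval⁺ {s} ≤-refl (≤-refl {s})
                  | (λ {w} → ∈-interval⁻ {s} {w} {s})
  ... | _ ∷ []    | _             | _ | _      = ≃-refl
  ... | y ∷ z ∷ L | (y≢z ∷ _) ∷ _ | _ | bounds =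
    ⊥-elim (y≢z (trans (equal (here refl)) (sym (equal (there (here refl))))))
    where
    equal : ∀ {w} → w ∈ y ∷ z ∷ L → w ≡ s
    equal w∈ = ≤-antisym (proj₂ (bounds w∈)) (proj₁ (bounds w∈))

  δ-< : ∀ {s t} → s < t → δ s t ≃ []
  δ-< {s} {t} (s≤t , s≢t) with interval s t | ∈-interval⁺ ≤-refl s≤t | ∈-interval⁺ s≤t ≤-refl
  ... | _ ∷ []    | here s≡y | here t≡y = ⊥-elim (s≢t (trans s≡y (sym t≡y)))
  ... | _ ∷ _ ∷ _ | _        | _        = ≃-refl

  IsIdentity⇒≃ᵢδ : ∀ {a} → IsIdentity P a → a ≃ᵢ δ
  IsIdentity⇒≃ᵢδ (diagonal , above) =
    ≃ᵢ-by-cases (λ s → ≃-trans (coeffwise (diagonal s)) (≃-sym (δ-diagonal s)))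
                (λ s<t → ≃-trans (coeffwise (above _ _ s<t)) (≃-sym (δ-< s<t)))

  infixl 6 _+ᵢ_
  _+ᵢ_ : Inc P → Inc P → Inc P
  (a +ᵢ b) s t = a s t +ₚ b s t

  infixr 7 _⊙_
  _⊙_ : Poly → Inc P → Inc P
  (c ⊙ a) s t = c *ₚ a s t

  infixl 7 _*ᵢ_
  _*ᵢ_ : Inc P → Inc P → Inc P
  _*ᵢ_ = _⊛_ P

  ⊖_ : Inc P → Inc P
  ⊖_ = -ᵢ_ P

  +ᵢ-cong : ∀ {a a′ b b′} → a ≃ᵢ a′ → b ≃ᵢ b′ → a +ᵢ b ≃ᵢ a′ +ᵢ b′
  +ᵢ-cong a≃a′ b≃b′ = on-intervals λ s≤t → +-cong (at a≃a′ s≤t) (at b≃b′ s≤t)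

  ⊙-cong : ∀ c {a b} → a ≃ᵢ b → c ⊙ a ≃ᵢ c ⊙ b
  ⊙-cong c a≃b = on-intervals λ s≤t → *-congˡ c (at a≃b s≤t)

  ⊖-cong : ∀ {a b} → a ≃ᵢ b → ⊖ a ≃ᵢ ⊖ b
  ⊖-cong a≃b = on-intervals λ s≤t → -‿cong (at a≃b s≤t)

  +ᵢ-cancelʳ : ∀ {a b c} → a +ᵢ c ≃ᵢ b +ᵢ c → a ≃ᵢ b
  +ᵢ-cancelʳ {a} {b} {c} e = on-intervals λ {s} {t} s≤t → +-cancelʳ (c s t) (a s t) (b s t) (at e s≤t)

  x-1⊙-cancel : ∀ {a b} → x-1 ⊙ a ≃ᵢ x-1 ⊙ b → a ≃ᵢ b
  x-1⊙-cancel e = on-intervals λ s≤t → x-1*-injective (at e s≤t)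

  ⊖≃ᵢ-1⊙ : ∀ a → ⊖ a ≃ᵢ -ₚ oneₚ ⊙ a
  ⊖≃ᵢ-1⊙ a = pointwise λ s t → ≃-sym (-1*x≈-x (a s t))

  ⊖-involutive : ∀ a → ⊖ ⊖ a ≃ᵢ a
  ⊖-involutive a = pointwise λ s t → -‿involutive (a s t)

  *ᵢ-cong : ∀ {a a′ b b′} → a ≃ᵢ a′ → b ≃ᵢ b′ → a *ᵢ b ≃ᵢ a′ *ᵢ b′
  *ᵢ-cong a≃a′ b≃b′ = on-intervals λ {s} {t} _ → ∑-cong (interval s t) λ w∈ →
    ℤ[x].*-cong (at a≃a′ (proj₁ (∈-interval⁻ w∈))) (at b≃b′ (proj₂ (∈-interval⁻ w∈)))

  *ᵢ-congˡ : ∀ a {b b′} → b ≃ᵢ b′ → a *ᵢ b ≃ᵢ a *ᵢ b′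
  *ᵢ-congˡ a = *ᵢ-cong (≃ᵢ-refl {a})

  *ᵢ-congʳ : ∀ b {a a′} → a ≃ᵢ a′ → a *ᵢ b ≃ᵢ a′ *ᵢ b
  *ᵢ-congʳ b a≃a′ = *ᵢ-cong a≃a′ (≃ᵢ-refl {b})

  *ᵢ-distribʳ : ∀ a b c → (a +ᵢ b) *ᵢ c ≃ᵢ a *ᵢ c +ᵢ b *ᵢ c
  *ᵢ-distribʳ a b c = pointwise λ s t → ≃-trans
    (∑-cong (interval s t) λ {w} _ → *-distribʳ (a s w) (b s w) (c w t))
    (∑-+ (interval s t) (λ w → a s w *ₚ c w t) (λ w → b s w *ₚ c w t))

  *ᵢ-distribˡ : ∀ a b c → a *ᵢ (b +ᵢ c) ≃ᵢ a *ᵢ b +ᵢ a *ᵢ c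
  *ᵢ-distribˡ a b c = pointwise λ s t → ≃-trans
    (∑-cong (interval s t) λ {w} _ → ℤ[x].distribˡ (a s w) (b w t) (c w t))
    (∑-+ (interval s t) (λ w → a s w *ₚ b w t) (λ w → a s w *ₚ c w t))

  ⊙-*ᵢ : ∀ c a b → (c ⊙ a) *ᵢ b ≃ᵢ c ⊙ (a *ᵢ b)
  ⊙-*ᵢ c a b = pointwise λ s t → ≃-trans
    (∑-cong (interval s t) λ {w} _ → *-assoc c (a s w) (b w t))
    (≃-sym (∑-*ˡ (interval s t) (λ w → a s w *ₚ b w t) c))

  *ᵢ-⊙ : ∀ c a b → a *ᵢ (c ⊙ b) ≃ᵢ c ⊙ (a *ᵢ b)
  *ᵢ-⊙ c a b = pointwise λ s t → ≃-trans
    (∑-cong (interval s t) λ {w} _ → x*[y*z]≃y*[x*z] (a s w) c (b w t))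
    (≃-sym (∑-*ˡ (interval s t) (λ w → a s w *ₚ b w t) c))

  ⊖-*ᵢ : ∀ a b → ⊖ a *ᵢ b ≃ᵢ ⊖ (a *ᵢ b)
  ⊖-*ᵢ a b = begin
    ⊖ a *ᵢ b                ≈⟨ *ᵢ-congʳ b (⊖≃ᵢ-1⊙ a) ⟩
    (-ₚ oneₚ ⊙ a) *ᵢ b      ≈⟨ ⊙-*ᵢ (-ₚ oneₚ) a b ⟩
    -ₚ oneₚ ⊙ (a *ᵢ b)      ≈⟨ ⊖≃ᵢ-1⊙ (a *ᵢ b) ⟨
    ⊖ (a *ᵢ b)              ∎
    where open ≃ᵢ-Reasoning

  *ᵢ-⊖ : ∀ a b → a *ᵢ ⊖ b ≃ᵢ ⊖ (a *ᵢ b)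
  *ᵢ-⊖ a b = begin
    a *ᵢ ⊖ b                ≈⟨ *ᵢ-congˡ a (⊖≃ᵢ-1⊙ b) ⟩
    a *ᵢ (-ₚ oneₚ ⊙ b)      ≈⟨ *ᵢ-⊙ (-ₚ oneₚ) a b ⟩
    -ₚ oneₚ ⊙ (a *ᵢ b)      ≈⟨ ⊖≃ᵢ-1⊙ (a *ᵢ b) ⟨
    ⊖ (a *ᵢ b)              ∎
    where open ≃ᵢ-Reasoning

  *ᵢ-diagonal : ∀ a b s → (a *ᵢ b) s s ≃ a s s *ₚ b s s
  *ᵢ-diagonal a b s = ∑-pick (∈-interval⁺ ≤-refl ≤-refl) (interval-unique s s)
    λ w∈ w≢s → ⊥-elim (w≢s (≤-antisym (proj₂ (∈-interval⁻ w∈)) (proj₁ (∈-interval⁻ w∈))))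

  δ-*ᵢ : ∀ a → δ *ᵢ a ≃ᵢ a
  δ-*ᵢ a = on-intervals λ {s} {t} s≤t → ≃-trans
    (∑-pick (∈-interval⁺ ≤-refl s≤t) (interval-unique s t)
      λ w∈ w≢s → *-congʳ (a _ t) (δ-< (proj₁ (∈-interval⁻ w∈) , ≢-sym w≢s)))
    (≃-trans (*-congʳ (a s t) (δ-diagonal s)) (*-identityˡ (a s t)))

  *ᵢ-δ : ∀ a → a *ᵢ δ ≃ᵢ a
  *ᵢ-δ a = on-intervals λ {s} {t} s≤t → ≃-trans
    (∑-pick (∈-interval⁺ s≤t ≤-refl) (interval-unique s t)
      λ {w} w∈ w≢t → ≃-trans (*-congˡ (a s w) (δ-< (proj₂ (∈-interval⁻ w∈) , w≢t))) (*-zeroʳ (a s w)))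
    (≃-trans (*-congˡ (a s t) (δ-diagonal t)) (ℤ[x].*-identityʳ (a s t)))

  ∈-triangle : ∀ {s t v w} → (w ∈ interval s t × v ∈ interval s w) ⇔ (v ∈ interval s t × w ∈ interval v t)
  ∈-triangle = mk⇔
    (λ (w∈ , v∈) → let (s≤w , w≤t) = ∈-interval⁻ w∈ ; (s≤v , v≤w) = ∈-interval⁻ v∈ in
      ∈-interval⁺ s≤v (≤-trans v≤w w≤t) , ∈-interval⁺ v≤w w≤t)
    (λ (v∈ , w∈) → let (s≤v , v≤t) = ∈-interval⁻ v∈ ; (v≤w , w≤t) = ∈-interval⁻ w∈ in
      ∈-interval⁺ (≤-trans s≤v v≤w) w≤t , ∈-interval⁺ s≤v v≤w)

  *ᵢ-assoc : ∀ a b c → (a *ᵢ b) *ᵢ c ≃ᵢ a *ᵢ (b *ᵢ c)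
  *ᵢ-assoc a b c = pointwise λ s t → begin
    ∑ [ s , t ] (λ w → ∑ [ s , w ] (λ v → a s v *ₚ b v w) *ₚ c w t)
      ≈⟨ ∑-cong [ s , t ] (λ {w} _ → ∑-*ʳ [ s , w ] (λ v → a s v *ₚ b v w) (c w t)) ⟩
    ∑ [ s , t ] (λ w → ∑ [ s , w ] (λ v → (a s v *ₚ b v w) *ₚ c w t))
      ≈⟨ ∑-exchange (interval-unique s t) (interval-unique s t) (interval-unique s) (λ v → interval-unique v t)
           ∈-triangle (λ w v → (a s v *ₚ b v w) *ₚ c w t) ⟩
    ∑ [ s , t ] (λ v → ∑ [ v , t ] (λ w → (a s v *ₚ b v w) *ₚ c w t))
      ≈⟨ ∑-cong [ s , t ] (λ {v} _ → ≃-trans (∑-cong [ v , t ] λ {w} _ → *-assoc (a s v) (b v w) (c w t))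
                                               (≃-sym (∑-*ˡ [ v , t ] (λ w → b v w *ₚ c w t) (a s v)))) ⟩
    ∑ [ s , t ] (λ v → a s v *ₚ ∑ [ v , t ] (λ w → b v w *ₚ c w t))
      ∎
    where
    open ≃-Reasoning
    [_,_] : Carrier → Carrier → List Carrier
    [_,_] = interval

  inverse-unique : ∀ {a b c} → b *ᵢ a ≃ᵢ δ → a *ᵢ c ≃ᵢ δ → b ≃ᵢ c
  inverse-unique {a} {b} {c} b*a≃δ a*c≃δ = begin
    b                ≈⟨ *ᵢ-δ b ⟨
    b *ᵢ δ           ≈⟨ *ᵢ-congˡ b a*c≃δ ⟨
    b *ᵢ (a *ᵢ c)    ≈⟨ *ᵢ-assoc b a c ⟨
    (b *ᵢ a) *ᵢ c    ≈⟨ *ᵢ-congʳ c b*a≃δ ⟩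
    δ *ᵢ c           ≈⟨ δ-*ᵢ c ⟩
    c                ∎
    where open ≃ᵢ-Reasoning

  ⊖-injective : ∀ {a b} → ⊖ a ≃ᵢ ⊖ b → a ≃ᵢ b
  ⊖-injective {a} {b} e = ≃ᵢ-trans (≃ᵢ-sym (⊖-involutive a)) (≃ᵢ-trans (⊖-cong e) (⊖-involutive b))

  x-1⊙⊖δ-above : ∀ a {s t} → s < t → (x-1 ⊙ ⊖ δ +ᵢ a) s t ≃ a s t
  x-1⊙⊖δ-above a s<t = +-cong (≃-trans (*-congˡ x-1 (-‿cong (δ-< s<t))) (*-zeroʳ x-1)) ≃-refl

module Ranked (P : LFPoset) (ρ : LFPoset.Carrier P → LFPoset.Carrier P → ℕ) (weak : IsWeakRank P ρ) where

  open LFPoset P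
  open IncidenceAlgebra P

  ρ-additive : ∀ {s w t} → s ≤ w → w ≤ t → ρ s t ≡ ρ s w +ℕ ρ w t
  ρ-additive = proj₂ weak _ _ _

  ρ-diagonal : ∀ s → ρ s s ≡ 0
  ρ-diagonal s = ℕ.+-cancelˡ-≡ (ρ s s) (ρ s s) 0
    (trans (sym (ρ-additive (≤-refl {s}) ≤-refl)) (sym (ℕ.+-identityʳ (ρ s s))))

  ρ-pred : ∀ {s t} → s < t → ρ s t ≡ suc (ρ s t ∸ 1)
  ρ-pred {s} {t} s<t with ρ s t | proj₁ weak s t s<t
  ... | suc _ | _ = refl

  ρ-mono : ∀ {s w t} → s ≤ w → w < t → ρ s w <ℕ ρ s t
  ρ-mono {s} {w} {t} s≤w (w≤t , w≢t) = subst (ρ s w <ℕ_) (sym (ρ-additive s≤w w≤t))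
    (ℕ.m<m+n (ρ s w) (proj₁ weak _ _ (w≤t , w≢t)))

  Deg≤ρ : ∀ {a} → InIρ P ρ a → ∀ {s t} → s ≤ t → Deg≤ (a s t) (ρ s t)
  Deg≤ρ a∈Iρ s≤t = deg≤ (a∈Iρ _ _ s≤t)

  revᵢ : Inc P → Inc P
  revᵢ = rev P ρ

  revᵢ-diagonal : ∀ a s → revᵢ a s s ≃ coeff (a s s) 0 ∷ []
  revᵢ-diagonal a s = ℤ[x].reflexive (cong (λ n → revₙ n (a s s)) (ρ-diagonal s))

  revᵢ-above : ∀ a {s t} → s < t → revᵢ a s t ≡ revₙ (suc (ρ s t ∸ 1)) (a s t)
  revᵢ-above a {s} {t} s<t = cong (λ n → revₙ n (a s t)) (ρ-pred s<t)

  revᵢ-cong : ∀ {a b} → a ≃ᵢ b → revᵢ a ≃ᵢ revᵢ b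
  revᵢ-cong a≃b = on-intervals λ s≤t → revₙ-cong (at a≃b s≤t)

  revᵢ-⊖ : ∀ a → revᵢ (⊖ a) ≃ᵢ ⊖ revᵢ a
  revᵢ-⊖ a = pointwise λ s t → revₙ-neg (ρ s t) (a s t)

  revᵢ-δ : revᵢ δ ≃ᵢ δ
  revᵢ-δ = ≃ᵢ-by-cases
    (λ s → ≃-trans (revᵢ-diagonal δ s) (≃-trans (∷-cong (coeff-≡ (δ-diagonal s) 0) ≃-refl) (≃-sym (δ-diagonal s))))
    (λ {s} {t} s<t → ≃-trans (revₙ-cong (δ-< s<t)) (≃-trans (revₙ-[] (ρ s t)) (≃-sym (δ-< s<t))))

  revᵢ-*ᵢ : ∀ {a b} → InIρ P ρ a → InIρ P ρ b → revᵢ (a *ᵢ b) ≃ᵢ revᵢ a *ᵢ revᵢ b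
  revᵢ-*ᵢ {a} {b} a∈Iρ b∈Iρ = on-intervals λ {s} {t} _ →
    ≃-trans (revₙ-∑ (ρ s t) (interval s t) (λ w → a s w *ₚ b w t))
      (∑-cong (interval s t) λ w∈ → split (∈-interval⁻ w∈))
    where
    split : ∀ {s w t} → s ≤ w × w ≤ t → revₙ (ρ s t) (a s w *ₚ b w t) ≃ revᵢ a s w *ₚ revᵢ b w t
    split {s} {w} {t} (s≤w , w≤t) = ≃-trans
      (ℤ[x].reflexive (cong (λ n → revₙ n (a s w *ₚ b w t)) (ρ-additive s≤w w≤t)))
      (revₙ-* (Deg≤ρ {a} a∈Iρ s≤w) (Deg≤ρ {b} b∈Iρ w≤t))

  -- By strong induction on ρ s t: (b a)_st = 0 determines b_st from the b_sw with w < t.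
  InIρ-left-inverse : ∀ {a b} → InIρ P ρ a → (∀ s → a s s ≃ oneₚ) → b *ᵢ a ≃ᵢ δ → InIρ P ρ b
  InIρ-left-inverse {a} {b} a∈Iρ a-diagonal b*a≃δ s t s≤t = vanish (<-rec Bounded bounded (ρ s t) s≤t refl)
    where
    Bounded : ℕ → Set
    Bounded n = ∀ {s t} → s ≤ t → ρ s t ≡ n → Deg≤ (b s t) n

    b-diagonal : ∀ s → b s s ≃ oneₚ
    b-diagonal s = begin
      b s s               ≈⟨ ℤ[x].*-identityʳ (b s s) ⟨
      b s s *ₚ oneₚ       ≈⟨ *-congˡ (b s s) (a-diagonal s) ⟨
      b s s *ₚ a s s      ≈⟨ *ᵢ-diagonal b a s ⟨
      (b *ᵢ a) s s        ≈⟨ at b*a≃δ ≤-refl ⟩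
      δ s s               ≈⟨ δ-diagonal s ⟩
      oneₚ                ∎
      where open ≃-Reasoning

    bounded : ∀ n → (∀ {m} → m <ℕ n → Bounded m) → Bounded n
    bounded _ ih {s} {t} s≤t refl with ≤⇒≡⊎< s≤t
    ... | inj₁ refl = Deg≤-cong (≃-sym (b-diagonal s)) (Deg≤-const 1ℤ)
    ... | inj₂ s<t  = Deg≤-cong (≃-trans (*-congˡ (b s t) (a-diagonal t)) (ℤ[x].*-identityʳ (b s t)))
      (Deg≤-∑-pick (∈-interval⁺ s≤t ≤-refl) (interval-unique s t) below
        (Deg≤-cong (≃-sym (≃-trans (at b*a≃δ s≤t) (δ-< s<t))) Deg≤-[]))
      where
      below : ∀ {w} → w ∈ interval s t → w ≢ t → Deg≤ (b s w *ₚ a w t) (ρ s t)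
      below w∈ w≢t = let (s≤w , w≤t) = ∈-interval⁻ w∈ in
        subst (Deg≤ _) (sym (ρ-additive s≤w w≤t))
          (Deg≤-* (ih (ρ-mono s≤w (w≤t , w≢t)) s≤w refl) (Deg≤ρ {a} a∈Iρ w≤t))

  -- Given G_ss = 1, condition (ii) in a form that is linear in G.
  IsSymmetric : Inc P → Set
  IsSymmetric G = revᵢ G ≃ᵢ x-1 ⊙ ⊖ δ +ᵢ x ⊙ G

  CondI∧CondII⇒IsSymmetric : ∀ {G} → CondI P ρ G → CondII P ρ G → IsSymmetric G
  CondI∧CondII⇒IsSymmetric {G} G-diagonal G-palindromic = ≃ᵢ-by-cases diagonal above
    where
    diagonal : ∀ s → revᵢ G s s ≃ x-1 *ₚ -ₚ δ s s +ₚ x *ₚ G s s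
    diagonal s = begin
      revᵢ G s s                               ≈⟨ revᵢ-diagonal G s ⟩
      coeff (G s s) 0 ∷ []                     ≈⟨ ∷-cong (G-diagonal s 0) ≃-refl ⟩
      oneₚ                                     ≈⟨ oneₚ-split ⟩
      x-1 *ₚ -ₚ oneₚ +ₚ x *ₚ oneₚ
        ≈⟨ +-cong (*-congˡ x-1 (-‿cong (δ-diagonal s))) (*-congˡ x (coeffwise {G s s} {oneₚ} (G-diagonal s))) ⟨
      x-1 *ₚ -ₚ δ s s +ₚ x *ₚ G s s            ∎
      where open ≃-Reasoning
    above : ∀ {s t} → s < t → revᵢ G s t ≃ x-1 *ₚ -ₚ δ s t +ₚ x *ₚ G s t
    above {s} {t} s<t = ≃-trans (ℤ[x].reflexive (revᵢ-above G s<t))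
      (≃-trans (palindrome⇒revₙ-suc (coeffwise (G-palindromic s t s<t))) (≃-sym (x-1⊙⊖δ-above (x ⊙ G) s<t)))

  IsSymmetric⇒CondII : ∀ {G} → IsSymmetric G → CondII P ρ G
  IsSymmetric⇒CondII {G} G-symmetric s t s<t = coeff-≡ (revₙ-suc⇒palindrome (begin
    revₙ (suc (ρ s t ∸ 1)) (G s t)    ≡⟨ revᵢ-above G s<t ⟨
    revᵢ G s t                        ≈⟨ at G-symmetric (proj₁ s<t) ⟩
    (x-1 ⊙ ⊖ δ +ᵢ x ⊙ G) s t          ≈⟨ x-1⊙⊖δ-above (x ⊙ G) s<t ⟩
    x *ₚ G s t                        ∎))
    where open ≃-Reasoning

  ≃ᵢrevᵢ⇔≃ᵢ⊖δ : ∀ {G c d} → IsSymmetric G → c ≃ᵢ x-1 ⊙ d +ᵢ x ⊙ G → (c ≃ᵢ revᵢ G ⇔ d ≃ᵢ ⊖ δ)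
  ≃ᵢrevᵢ⇔≃ᵢ⊖δ {G} {c} {d} G-symmetric c-split = mk⇔
    (λ c≃revG → x-1⊙-cancel (+ᵢ-cancelʳ (≃ᵢ-trans (≃ᵢ-sym c-split) (≃ᵢ-trans c≃revG G-symmetric))))
    (λ d≃⊖δ → ≃ᵢ-trans c-split (≃ᵢ-trans (+ᵢ-cong (⊙-cong x-1 d≃⊖δ) (≃ᵢ-refl {x ⊙ G})) (≃ᵢ-sym G-symmetric)))

module Kernel (P : LFPoset) (ρ : LFPoset.Carrier P → LFPoset.Carrier P → ℕ) (weak : IsWeakRank P ρ)
              (κ : Inc P) (κ-kernel : IsKernel P ρ κ) (κ̄ : Inc P) (κ̄-reduced : IsReducedKernel P ρ κ κ̄) where

  open LFPoset P
  open IncidenceAlgebra P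
  open Ranked P ρ weak

  κ-diagonal : ∀ s → κ s s ≃ oneₚ
  κ-diagonal s = coeffwise (proj₁ (proj₂ κ-kernel) s)

  κ̄-diagonal : ∀ s → κ̄ s s ≃ -ₚ oneₚ
  κ̄-diagonal s = coeffwise (proj₁ κ̄-reduced s)

  κ-above : ∀ {s t} → s < t → κ s t ≃ x-1 *ₚ κ̄ s t
  κ-above s<t = ≃-sym (coeffwise (proj₂ κ̄-reduced _ _ s<t))

  κ-split : κ ≃ᵢ x-1 ⊙ κ̄ +ᵢ x ⊙ δ
  κ-split = ≃ᵢ-by-cases diagonal above
    where
    diagonal : ∀ s → κ s s ≃ x-1 *ₚ κ̄ s s +ₚ x *ₚ δ s s
    diagonal s = begin
      κ s s                             ≈⟨ κ-diagonal s ⟩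
      oneₚ                              ≈⟨ oneₚ-split ⟩
      x-1 *ₚ -ₚ oneₚ +ₚ x *ₚ oneₚ       ≈⟨ +-cong (*-congˡ x-1 (κ̄-diagonal s)) (*-congˡ x (δ-diagonal s)) ⟨
      x-1 *ₚ κ̄ s s +ₚ x *ₚ δ s s        ∎
      where open ≃-Reasoning
    above : ∀ {s t} → s < t → κ s t ≃ x-1 *ₚ κ̄ s t +ₚ x *ₚ δ s t
    above {s} {t} s<t = ≃-trans (κ-above s<t) (≃-sym (≃-trans
      (+-cong (≃-refl {x-1 *ₚ κ̄ s t}) (≃-trans (*-congˡ x (δ-< s<t)) (*-zeroʳ x))) (+-identityʳ _)))

  κ-*ᵢ : ∀ a → κ *ᵢ a ≃ᵢ x-1 ⊙ (κ̄ *ᵢ a) +ᵢ x ⊙ a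
  κ-*ᵢ a = begin
    κ *ᵢ a                                  ≈⟨ *ᵢ-congʳ a κ-split ⟩
    (x-1 ⊙ κ̄ +ᵢ x ⊙ δ) *ᵢ a                 ≈⟨ *ᵢ-distribʳ (x-1 ⊙ κ̄) (x ⊙ δ) a ⟩
    (x-1 ⊙ κ̄) *ᵢ a +ᵢ (x ⊙ δ) *ᵢ a          ≈⟨ +ᵢ-cong (⊙-*ᵢ x-1 κ̄ a) (⊙-*ᵢ x δ a) ⟩
    x-1 ⊙ (κ̄ *ᵢ a) +ᵢ x ⊙ (δ *ᵢ a)          ≈⟨ +ᵢ-cong (≃ᵢ-refl {x-1 ⊙ (κ̄ *ᵢ a)}) (⊙-cong x (δ-*ᵢ a)) ⟩
    x-1 ⊙ (κ̄ *ᵢ a) +ᵢ x ⊙ a                 ∎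
    where open ≃ᵢ-Reasoning

  *ᵢ-κ : ∀ a → a *ᵢ κ ≃ᵢ x-1 ⊙ (a *ᵢ κ̄) +ᵢ x ⊙ a
  *ᵢ-κ a = begin
    a *ᵢ κ                                  ≈⟨ *ᵢ-congˡ a κ-split ⟩
    a *ᵢ (x-1 ⊙ κ̄ +ᵢ x ⊙ δ)                 ≈⟨ *ᵢ-distribˡ a (x-1 ⊙ κ̄) (x ⊙ δ) ⟩
    a *ᵢ (x-1 ⊙ κ̄) +ᵢ a *ᵢ (x ⊙ δ)          ≈⟨ +ᵢ-cong (*ᵢ-⊙ x-1 a κ̄) (*ᵢ-⊙ x a δ) ⟩
    x-1 ⊙ (a *ᵢ κ̄) +ᵢ x ⊙ (a *ᵢ δ)          ≈⟨ +ᵢ-cong (≃ᵢ-refl {x-1 ⊙ (a *ᵢ κ̄)}) (⊙-cong x (*ᵢ-δ a)) ⟩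
    x-1 ⊙ (a *ᵢ κ̄) +ᵢ x ⊙ a                 ∎
    where open ≃ᵢ-Reasoning

  κ̄-degree-above : ∀ {s t} → s < t → Deg≤ (κ̄ s t) (ρ s t ∸ 1)
  κ̄-degree-above {s} {t} s<t = Deg≤-x-1*⁻
    (subst (Deg≤ (x-1 *ₚ κ̄ s t)) (ρ-pred s<t) (Deg≤-cong (κ-above s<t) (Deg≤ρ {κ} (proj₁ κ-kernel) (proj₁ s<t))))

  κ̄∈Iρ : InIρ P ρ κ̄
  κ̄∈Iρ s t s≤t with ≤⇒≡⊎< s≤t
  ... | inj₁ refl = vanish (Deg≤-cong (≃-sym (κ̄-diagonal s)) (Deg≤-const -1ℤ))
  ... | inj₂ s<t  = vanish (subst (Deg≤ (κ̄ s t)) (sym (ρ-pred s<t)) (Deg≤-mono (ℕ.n≤1+n _) (κ̄-degree-above s<t)))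

  revκ-split : x ⊙ revᵢ κ +ᵢ x-1 ⊙ revᵢ κ̄ ≃ᵢ δ
  revκ-split = ≃ᵢ-by-cases diagonal above
    where
    diagonal : ∀ s → x *ₚ revᵢ κ s s +ₚ x-1 *ₚ revᵢ κ̄ s s ≃ δ s s
    diagonal s = begin
      x *ₚ revᵢ κ s s +ₚ x-1 *ₚ revᵢ κ̄ s s
        ≈⟨ +-cong (*-congˡ x (≃-trans (revᵢ-diagonal κ s) (∷-cong (coeff-≡ (κ-diagonal s) 0) ≃-refl)))
                  (*-congˡ x-1 (≃-trans (revᵢ-diagonal κ̄ s) (∷-cong (coeff-≡ (κ̄-diagonal s) 0) ≃-refl))) ⟩
      x *ₚ oneₚ +ₚ x-1 *ₚ -ₚ oneₚ          ≈⟨ ≃-trans (+-comm (x *ₚ oneₚ) (x-1 *ₚ -ₚ oneₚ)) (≃-sym oneₚ-split) ⟩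
      oneₚ                                  ≈⟨ δ-diagonal s ⟨
      δ s s                                 ∎
      where open ≃-Reasoning
    above : ∀ {s t} → s < t → x *ₚ revᵢ κ s t +ₚ x-1 *ₚ revᵢ κ̄ s t ≃ δ s t
    above {s} {t} s<t = begin
      x *ₚ revᵢ κ s t +ₚ x-1 *ₚ revᵢ κ̄ s t
        ≡⟨ cong₂ (λ p q → x *ₚ p +ₚ x-1 *ₚ q) (revᵢ-above κ s<t) (revᵢ-above κ̄ s<t) ⟩
      x *ₚ revₙ (suc n) (κ s t) +ₚ x-1 *ₚ revₙ (suc n) (κ̄ s t)
        ≈⟨ +-cong (*-congˡ x (≃-trans (revₙ-cong (κ-above s<t)) (revₙ-x-1* (κ̄-degree-above s<t))))
                  (*-congˡ x-1 (≃-trans (revₙ-shift (κ̄-degree-above s<t)) (≃-sym (x*p≃0∷p r)))) ⟩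
      x *ₚ (-ₚ x-1 *ₚ r) +ₚ x-1 *ₚ (x *ₚ r)
        ≈⟨ cancels x-1 r ⟩
      []                                    ≈⟨ δ-< s<t ⟨
      δ s t                                 ∎
      where
      open ≃-Reasoning
      n : ℕ
      n = ρ s t ∸ 1
      r : Poly
      r = revₙ n (κ̄ s t)
      cancels : ∀ m r → (m +ₚ oneₚ) *ₚ (-ₚ m *ₚ r) +ₚ m *ₚ ((m +ₚ oneₚ) *ₚ r) ≃ []
      cancels = solve-∀ ℤ[x]-solver

  κ̄-split : κ̄ ≃ᵢ x ⊙ revᵢ κ̄ +ᵢ x-1 ⊙ (κ̄ *ᵢ revᵢ κ̄)
  κ̄-split = x-1⊙-cancel (+ᵢ-cancelʳ (begin
    x-1 ⊙ κ̄ +ᵢ x ⊙ δ                                    ≈⟨ κ-split ⟨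
    κ                                                   ≈⟨ *ᵢ-δ κ ⟨
    κ *ᵢ δ                                              ≈⟨ *ᵢ-congˡ κ revκ-split ⟨
    κ *ᵢ (x ⊙ R +ᵢ x-1 ⊙ K)                             ≈⟨ *ᵢ-distribˡ κ (x ⊙ R) (x-1 ⊙ K) ⟩
    κ *ᵢ (x ⊙ R) +ᵢ κ *ᵢ (x-1 ⊙ K)                      ≈⟨ +ᵢ-cong (*ᵢ-⊙ x κ R) (*ᵢ-⊙ x-1 κ K) ⟩
    x ⊙ (κ *ᵢ R) +ᵢ x-1 ⊙ (κ *ᵢ K)                      ≈⟨ +ᵢ-cong (⊙-cong x κ*R≃δ) (⊙-cong x-1 (κ-*ᵢ K)) ⟩
    x ⊙ δ +ᵢ x-1 ⊙ (x-1 ⊙ (κ̄ *ᵢ K) +ᵢ x ⊙ K)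
      ≈⟨ pointwise (λ s t → rearrange x-1 (δ s t) ((κ̄ *ᵢ K) s t) (K s t)) ⟩
    x-1 ⊙ (x ⊙ K +ᵢ x-1 ⊙ (κ̄ *ᵢ K)) +ᵢ x ⊙ δ             ∎))
    where
    open ≃ᵢ-Reasoning
    R : Inc P
    R = revᵢ κ
    K : Inc P
    K = revᵢ κ̄
    κ*R≃δ : κ *ᵢ R ≃ᵢ δ
    κ*R≃δ = IsIdentity⇒≃ᵢδ (proj₁ (proj₂ (proj₂ κ-kernel)))
    rearrange : ∀ m d q k → (m +ₚ oneₚ) *ₚ d +ₚ m *ₚ (m *ₚ q +ₚ (m +ₚ oneₚ) *ₚ k)
                          ≃ m *ₚ ((m +ₚ oneₚ) *ₚ k +ₚ m *ₚ q) +ₚ (m +ₚ oneₚ) *ₚ d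
    rearrange = solve-∀ ℤ[x]-solver

module Chow (P : LFPoset) (ρ : LFPoset.Carrier P → LFPoset.Carrier P → ℕ) (weak : IsWeakRank P ρ)
            (κ : Inc P) (κ-kernel : IsKernel P ρ κ) (κ̄ : Inc P) (κ̄-reduced : IsReducedKernel P ρ κ κ̄)
            (H : Inc P) (κ̄-inverse : IsInverse P κ̄ (-ᵢ_ P H)) where

  open LFPoset P
  open IncidenceAlgebra P
  open Ranked P ρ weak
  open Kernel P ρ weak κ κ-kernel κ̄ κ̄-reduced public

  κ̄*⊖H≃δ : κ̄ *ᵢ ⊖ H ≃ᵢ δ
  κ̄*⊖H≃δ = IsIdentity⇒≃ᵢδ (proj₁ κ̄-inverse)

  ⊖H*κ̄≃δ : ⊖ H *ᵢ κ̄ ≃ᵢ δ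
  ⊖H*κ̄≃δ = IsIdentity⇒≃ᵢδ (proj₂ κ̄-inverse)

  κ̄*H≃⊖δ : κ̄ *ᵢ H ≃ᵢ ⊖ δ
  κ̄*H≃⊖δ = ⊖-injective (≃ᵢ-trans (≃ᵢ-sym (*ᵢ-⊖ κ̄ H)) (≃ᵢ-trans κ̄*⊖H≃δ (≃ᵢ-sym (⊖-involutive δ))))

  H*κ̄≃⊖δ : H *ᵢ κ̄ ≃ᵢ ⊖ δ
  H*κ̄≃⊖δ = ⊖-injective (≃ᵢ-trans (≃ᵢ-sym (⊖-*ᵢ H κ̄)) (≃ᵢ-trans ⊖H*κ̄≃δ (≃ᵢ-sym (⊖-involutive δ))))

  H-diagonal : ∀ s → H s s ≃ oneₚ
  H-diagonal s = begin
    H s s                        ≈⟨ negate (H s s) ⟩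
    -ₚ H s s *ₚ -ₚ oneₚ          ≈⟨ *-congˡ (-ₚ H s s) (κ̄-diagonal s) ⟨
    -ₚ H s s *ₚ κ̄ s s            ≈⟨ *ᵢ-diagonal (⊖ H) κ̄ s ⟨
    (⊖ H *ᵢ κ̄) s s               ≈⟨ at ⊖H*κ̄≃δ ≤-refl ⟩
    δ s s                        ≈⟨ δ-diagonal s ⟩
    oneₚ                         ∎
    where
    open ≃-Reasoning
    negate : ∀ h → h ≃ -ₚ h *ₚ -ₚ oneₚ
    negate = solve-∀ ℤ[x]-solver

  H∈Iρ : InIρ P ρ H
  H∈Iρ = InIρ-left-inverse {⊖ κ̄} {H}
    (λ s t s≤t → vanish (Deg≤-neg (Deg≤ρ {κ̄} κ̄∈Iρ s≤t)))
    (λ s → ≃-trans (-‿cong (κ̄-diagonal s)) (-‿involutive oneₚ))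
    (≃ᵢ-trans (*ᵢ-⊖ H κ̄) (≃ᵢ-trans (⊖-cong H*κ̄≃⊖δ) (⊖-involutive δ)))

  revκ̄*revH≃⊖δ : revᵢ κ̄ *ᵢ revᵢ H ≃ᵢ ⊖ δ
  revκ̄*revH≃⊖δ = begin
    revᵢ κ̄ *ᵢ revᵢ H      ≈⟨ revᵢ-*ᵢ {κ̄} {H} κ̄∈Iρ H∈Iρ ⟨
    revᵢ (κ̄ *ᵢ H)         ≈⟨ revᵢ-cong κ̄*H≃⊖δ ⟩
    revᵢ (⊖ δ)            ≈⟨ revᵢ-⊖ δ ⟩
    ⊖ revᵢ δ              ≈⟨ ⊖-cong revᵢ-δ ⟩
    ⊖ δ                   ∎
    where open ≃ᵢ-Reasoning

  κ̄*revH : κ̄ *ᵢ revᵢ H ≃ᵢ x ⊙ ⊖ δ +ᵢ x-1 ⊙ ⊖ κ̄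
  κ̄*revH = begin
    κ̄ *ᵢ H′                                    ≈⟨ *ᵢ-congʳ H′ κ̄-split ⟩
    (x ⊙ K +ᵢ x-1 ⊙ (κ̄ *ᵢ K)) *ᵢ H′             ≈⟨ *ᵢ-distribʳ (x ⊙ K) (x-1 ⊙ (κ̄ *ᵢ K)) H′ ⟩
    (x ⊙ K) *ᵢ H′ +ᵢ (x-1 ⊙ (κ̄ *ᵢ K)) *ᵢ H′      ≈⟨ +ᵢ-cong (⊙-*ᵢ x K H′) (⊙-*ᵢ x-1 (κ̄ *ᵢ K) H′) ⟩
    x ⊙ (K *ᵢ H′) +ᵢ x-1 ⊙ ((κ̄ *ᵢ K) *ᵢ H′)      ≈⟨ +ᵢ-cong (⊙-cong x revκ̄*revH≃⊖δ) (⊙-cong x-1 (*ᵢ-assoc κ̄ K H′)) ⟩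
    x ⊙ ⊖ δ +ᵢ x-1 ⊙ (κ̄ *ᵢ (K *ᵢ H′))           ≈⟨ +ᵢ-cong (≃ᵢ-refl {x ⊙ ⊖ δ}) (⊙-cong x-1 (*ᵢ-congˡ κ̄ revκ̄*revH≃⊖δ)) ⟩
    x ⊙ ⊖ δ +ᵢ x-1 ⊙ (κ̄ *ᵢ ⊖ δ)                 ≈⟨ +ᵢ-cong (≃ᵢ-refl {x ⊙ ⊖ δ}) (⊙-cong x-1 κ̄*⊖δ) ⟩
    x ⊙ ⊖ δ +ᵢ x-1 ⊙ ⊖ κ̄                        ∎
    where
    open ≃ᵢ-Reasoning
    K : Inc P
    K = revᵢ κ̄
    H′ : Inc P
    H′ = revᵢ H
    κ̄*⊖δ : κ̄ *ᵢ ⊖ δ ≃ᵢ ⊖ κ̄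
    κ̄*⊖δ = ≃ᵢ-trans (*ᵢ-⊖ κ̄ δ) (⊖-cong (*ᵢ-δ κ̄))

  H-symmetric : IsSymmetric H
  H-symmetric = begin
    H′                                           ≈⟨ δ-*ᵢ H′ ⟨
    δ *ᵢ H′                                      ≈⟨ *ᵢ-congʳ H′ ⊖H*κ̄≃δ ⟨
    (⊖ H *ᵢ κ̄) *ᵢ H′                             ≈⟨ *ᵢ-assoc (⊖ H) κ̄ H′ ⟩
    ⊖ H *ᵢ (κ̄ *ᵢ H′)                             ≈⟨ *ᵢ-congˡ (⊖ H) κ̄*revH ⟩
    ⊖ H *ᵢ (x ⊙ ⊖ δ +ᵢ x-1 ⊙ ⊖ κ̄)                 ≈⟨ *ᵢ-distribˡ (⊖ H) (x ⊙ ⊖ δ) (x-1 ⊙ ⊖ κ̄) ⟩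
    ⊖ H *ᵢ (x ⊙ ⊖ δ) +ᵢ ⊖ H *ᵢ (x-1 ⊙ ⊖ κ̄)        ≈⟨ +ᵢ-cong (*ᵢ-⊙ x (⊖ H) (⊖ δ)) (*ᵢ-⊙ x-1 (⊖ H) (⊖ κ̄)) ⟩
    x ⊙ (⊖ H *ᵢ ⊖ δ) +ᵢ x-1 ⊙ (⊖ H *ᵢ ⊖ κ̄)        ≈⟨ +ᵢ-cong (⊙-cong x ⊖H*⊖δ) (⊙-cong x-1 ⊖H*⊖κ̄) ⟩
    x ⊙ H +ᵢ x-1 ⊙ ⊖ δ                           ≈⟨ pointwise (λ s t → +-comm (x *ₚ H s t) (x-1 *ₚ -ₚ δ s t)) ⟩
    x-1 ⊙ ⊖ δ +ᵢ x ⊙ H                           ∎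
    where
    open ≃ᵢ-Reasoning
    H′ : Inc P
    H′ = revᵢ H
    ⊖H*⊖δ : ⊖ H *ᵢ ⊖ δ ≃ᵢ H
    ⊖H*⊖δ = ≃ᵢ-trans (*ᵢ-⊖ (⊖ H) δ) (≃ᵢ-trans (⊖-cong (*ᵢ-δ (⊖ H))) (⊖-involutive H))
    ⊖H*⊖κ̄ : ⊖ H *ᵢ ⊖ κ̄ ≃ᵢ ⊖ δ
    ⊖H*⊖κ̄ = ≃ᵢ-trans (*ᵢ-⊖ (⊖ H) κ̄) (⊖-cong ⊖H*κ̄≃δ)

  κ*H≃revH : κ *ᵢ H ≃ᵢ revᵢ H
  κ*H≃revH = Equivalence.from (≃ᵢrevᵢ⇔≃ᵢ⊖δ H-symmetric (κ-*ᵢ H)) κ̄*H≃⊖δ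

  H*κ≃revH : H *ᵢ κ ≃ᵢ revᵢ H
  H*κ≃revH = Equivalence.from (≃ᵢrevᵢ⇔≃ᵢ⊖δ H-symmetric (*ᵢ-κ H)) H*κ̄≃⊖δ

  κ̄*G≃⊖δ⇒G≃H : ∀ {G} → κ̄ *ᵢ G ≃ᵢ ⊖ δ → G ≃ᵢ H
  κ̄*G≃⊖δ⇒G≃H {G} κ̄*G≃⊖δ = ⊖-injective (≃ᵢ-sym (inverse-unique ⊖H*κ̄≃δ
    (≃ᵢ-trans (*ᵢ-⊖ κ̄ G) (≃ᵢ-trans (⊖-cong κ̄*G≃⊖δ) (⊖-involutive δ)))))

  G*κ̄≃⊖δ⇒G≃H : ∀ {G} → G *ᵢ κ̄ ≃ᵢ ⊖ δ → G ≃ᵢ H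
  G*κ̄≃⊖δ⇒G≃H {G} G*κ̄≃⊖δ = ⊖-injective (inverse-unique
    (≃ᵢ-trans (⊖-*ᵢ G κ̄) (≃ᵢ-trans (⊖-cong G*κ̄≃⊖δ) (⊖-involutive δ))) κ̄*⊖H≃δ)

  unique : ∀ {G} → CondI P ρ G → CondII P ρ G → κ *ᵢ G ≃ᵢ revᵢ G ⊎ G *ᵢ κ ≃ᵢ revᵢ G → G ≃ᵢ H
  unique {G} G-diagonal G-palindromic =
    [ κ̄*G≃⊖δ⇒G≃H {G} ∘ Equivalence.to (equation (κ-*ᵢ G))
    , G*κ̄≃⊖δ⇒G≃H {G} ∘ Equivalence.to (equation (*ᵢ-κ G)) ]′
    where
    equation : ∀ {c d} → c ≃ᵢ x-1 ⊙ d +ᵢ x ⊙ G → (c ≃ᵢ revᵢ G ⇔ d ≃ᵢ ⊖ δ)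
    equation = ≃ᵢrevᵢ⇔≃ᵢ⊖δ (CondI∧CondII⇒IsSymmetric G-diagonal G-palindromic)

proposition3p6 : (P : LFPoset) (ρ : LFPoset.Carrier P → LFPoset.Carrier P → ℕ) →
  IsWeakRank P ρ →
  (κ : Inc P) → IsKernel P ρ κ →
  (H : Inc P) → IsChowFunction P ρ κ H →
  (InIρ P ρ H × CondI P ρ H × CondII P ρ H ×
   (_≈ᵢ_ P (_⊛_ P κ H) (rev P ρ H) × _≈ᵢ_ P (_⊛_ P H κ) (rev P ρ H))) ×
  ((G : Inc P) → InIρ P ρ G → CondI P ρ G → CondII P ρ G →
    (_≈ᵢ_ P (_⊛_ P κ G) (rev P ρ G) ⊎ _≈ᵢ_ P (_⊛_ P G κ) (rev P ρ G)) →
    _≈ᵢ_ P G H)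
proposition3p6 P ρ weak κ κ-kernel H (κ̄ , κ̄-reduced , κ̄-inverse) =
  (H∈Iρ , (λ s → coeff-≡ (H-diagonal s)) , IsSymmetric⇒CondII H-symmetric , ≃ᵢ⇒≈ᵢ κ*H≃revH , ≃ᵢ⇒≈ᵢ H*κ≃revH) ,
  λ G _ G-diagonal G-palindromic equation →
    ≃ᵢ⇒≈ᵢ (unique {G} G-diagonal G-palindromic (Sum.map ≈ᵢ⇒≃ᵢ ≈ᵢ⇒≃ᵢ equation))
  where
  open IncidenceAlgebra P
  open Ranked P ρ weak
  open Chow P ρ weak κ κ-kernel κ̄ κ̄-reduced H κ̄-inverse
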